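{- Let $n\ge4$ and $r\ge1$. For each isomorphism type $\mathcal F$ of finite forests (without isolated vertices) having between $1$ and $r$ edges, there is a number $C_{r,\mathcal F}(n)$ depending only on $r$, $n$ and $\mathcal F$, such that for every tree $T$ on the vertex set $[n]$, $$M_r^{(2)}(T)=\sum_{\mathcal F}N_{\mathcal F}(T)\,C_{r,\mathcal F}(n),$$ where $N_{\mathcal F}(T)$ is the number of edge-induced subforests of $T$ (i.e. subsets of $E(T)$ together with their incident vertices) isomorphic to $\mathcal F$.
   Context: $M_r^{(2)}(T)=\operatorname{tr}\big((X_T|_{W_n})^r\big)$, where $V_n$ is the complex vector space with basis $e_{ij}$ indexed by unordered pairs $\{i,j\}\subset[n]$ with $S_n$ acting by $\sigma e_{ij}=e_{\sigma(i)\sigma(j)}$, $W_n=\{z\in V_n:\sum_{j\ne i}z_{ij}=0\ \forall i\}$, and $X_T=\sum_{ij\in E(T)}(ij)\in\mathbb C[S_n]$ acting on $W_n$. -}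

module Defs where

open import Data.Nat using (ℕ; zero; suc; _≤_)
import Data.Nat
open import Data.Fin using (Fin; zero; suc; _<_; _≟_)
open import Data.Fin.Permutation using (Permutation′)
open import Data.Product using (_×_; _,_; Σ; ∃)
open import Data.Sum using (_⊎_)
open import Data.List using (List; []; _∷_; _++_; map; length; _∷ʳ_)
open import Data.List.Membership.Propositional using (_∈_)
open import Data.List.Relation.Unary.All using (All)
open import Data.List.Relation.Unary.Unique.Propositional using (Unique)
open import Data.List.Relation.Unary.Linked using (Linked)
open import Data.Rational using (ℚ; 0ℚ; 1ℚ; _+_; _*_)
open import Relation.Binary.Construct.Closure.ReflexiveTransitive using (Star)
open import Relation.Binary.PropositionalEquality using (_≡_)
open import Relation.Nullary using (yes; no)
open import Function.Bundles using (Inverse; _⇔_)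

sumFin : ∀ {m} → (Fin m → ℚ) → ℚ
sumFin {zero}  f = 0ℚ
sumFin {suc m} f = f zero + sumFin (λ i → f (suc i))

sumList : ∀ {A : Set} → (A → ℚ) → List A → ℚ
sumList f []       = 0ℚ
sumList f (x ∷ xs) = f x + sumList f xs

subsets : ∀ {A : Set} → List A → List (List A)
subsets []       = [] ∷ []
subsets (x ∷ xs) = subsets xs ++ map (x ∷_) (subsets xs)

-- Graphs on [n] = Fin n given by an edge list; an edge is (a , b) with a < b,
-- standing for the unordered pair {a , b}.

EdgeList : ℕ → Set
EdgeList n = List (Fin n × Fin n)

Adj : ∀ {n} → EdgeList n → Fin n → Fin n → Set
Adj E a b = ((a , b) ∈ E) ⊎ ((b , a) ∈ E)

IsSimple : ∀ {n} → EdgeList n → Set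
IsSimple E = All (λ e → Data.Product.proj₁ e < Data.Product.proj₂ e) E × Unique E

Connected : ∀ {n} → EdgeList n → Set
Connected E = ∀ u v → Star (Adj E) u v

-- a cycle: distinct vertices v₀ … v_{k-1}, k ≥ 3, consecutive ones adjacent
-- and v_{k-1} adjacent to v₀
HasCycle : ∀ {n} → EdgeList n → Set
HasCycle {n} E =
  Σ (Fin n) λ v → Σ (List (Fin n)) λ ws →
    (2 ≤ length ws) × Unique (v ∷ ws) × Linked (Adj E) ((v ∷ ws) ∷ʳ v)

IsTree : ∀ {n} → EdgeList n → Set
IsTree E = IsSimple E × Connected E × (HasCycle E → Data.Empty.⊥)
  where import Data.Empty

-- Two edge-induced subgraphs (given by edge sets S, S' inside [n]) are
-- isomorphic: a bijection of the vertex sets preserving adjacency, which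
-- (both vertex sets lying in [n] and having equal size) is the same as a
-- permutation of [n] carrying S onto S'.
Isomorphic : ∀ {n} → EdgeList n → EdgeList n → Set
Isomorphic {n} S S' = Σ (Permutation′ n) λ σ →
  ∀ a b → Adj S a b ⇔ Adj S' (Inverse.to σ a) (Inverse.to σ b)

-- A vector z = Σ z_{ij} e_{ij} is stored as a function Fin n → Fin n → ℚ
-- which is symmetric with zero diagonal (z i j = coefficient of e_{ij}).

Vec' : ℕ → Set
Vec' n = Fin n → Fin n → ℚ

InV : ∀ {n} → Vec' n → Set
InV z = (∀ i j → z i j ≡ z j i) × (∀ i → z i i ≡ 0ℚ)

InW : ∀ {n} → Vec' n → Set
InW z = ∀ i → sumFin (λ j → offDiag i j) ≡ 0ℚ
  where offDiag : _ → _ → ℚ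
        offDiag i j with j ≟ i
        ... | yes _ = 0ℚ
        ... | no  _ = z i j

_≈V_ : ∀ {n} → Vec' n → Vec' n → Set
z ≈V w = ∀ i j → z i j ≡ w i j

swap : ∀ {n} → Fin n → Fin n → Fin n → Fin n
swap a b k with k ≟ a
... | yes _ = b
... | no  _ with k ≟ b
...   | yes _ = a
...   | no  _ = k

-- action of a transposition τ on V_n: (τ z)_{ij} = z_{τ⁻¹ i, τ⁻¹ j}, τ⁻¹ = τ
actSwap : ∀ {n} → Fin n → Fin n → Vec' n → Vec' n
actSwap a b z i j = z (swap a b i) (swap a b j)

X : ∀ {n} → EdgeList n → Vec' n → Vec' n
X E z i j = sumList (λ e → actSwap (Data.Product.proj₁ e) (Data.Product.proj₂ e) z i j) E

lincomb : ∀ {n d} → (Fin d → ℚ) → (Fin d → Vec' n) → Vec' n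
lincomb c b i j = sumFin (λ k → c k * b k i j)

IsBasisW : ∀ {n d} → (Fin d → Vec' n) → Set
IsBasisW {n} {d} b =
  (∀ k → InV (b k) × InW (b k)) ×
  (∀ (c : Fin d → ℚ) → lincomb c b ≈V (λ _ _ → 0ℚ) → ∀ k → c k ≡ 0ℚ) ×
  (∀ (z : Vec' n) → InV z → InW z → ∃ λ (c : Fin d → ℚ) → z ≈V lincomb c b)

-- A (column convention) is the matrix of X_T|_{W_n} in the basis b
IsMatrixOf : ∀ {n d} → EdgeList n → (Fin d → Vec' n) → (Fin d → Fin d → ℚ) → Set
IsMatrixOf E b A = ∀ k → X E (b k) ≈V lincomb (λ l → A l k) b

Mat : ℕ → Set
Mat d = Fin d → Fin d → ℚ

matMul : ∀ {d} → Mat d → Mat d → Mat d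
matMul A B i j = sumFin (λ k → A i k * B k j)

identity : ∀ {d} → Mat d
identity i j with i ≟ j
... | yes _ = 1ℚ
... | no  _ = 0ℚ

matPow : ∀ {d} → Mat d → ℕ → Mat d
matPow A zero    = identity
matPow A (suc r) = matMul A (matPow A r)

trace : ∀ {d} → Mat d → ℚ
trace A = sumFin (λ k → A k k)

-- Σ_𝓕 N_𝓕(T) C_𝓕 : sum over edge subsets S ⊆ E(T) with 1 ≤ |S| ≤ r of
-- C evaluated at (the isomorphism type of) S.

forestSum : ∀ {n} → ℕ → (EdgeList n → ℚ) → EdgeList n → ℚ
forestSum r C E = sumList term (subsets E)
  where term : _ → ℚ
        term S with 1 Data.Nat.≤? length S | length S Data.Nat.≤? r
        ... | yes _ | yes _ = C S
        ... | _     | _     = 0ℚ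

-- Expanding X_T^r = (Σ_{e ∈ E(T)} e)^r gives a sum over words w of r transpositions; summing over
-- ordered pairs (a , b), a word has weight 2^-r if all its letters are edges of T and 0 otherwise.
-- The trace of an operator g on W_n needs no basis of W_n: it is Σ_{i ≠ j} ½ (g (π e_ij))_ij, where
-- π is the orthogonal projection of V_n onto W_n, and this functional is invariant under
-- conjugation by S_n. Grouping the words according to the edge set S ⊆ E(T) they use, S contributes
-- C(S) = 2^-r Σ_{w uses exactly S} tr(w|W_n), and relabelling the vertices shows that C(S) only
-- depends on the isomorphism type of S. A word of length r uses between 1 and r edges.

{-# OPTIONS --safe #-}
module Submission where

open import Defs

open import Level using (0ℓ)
open import Algebra.Bundles using (CommutativeMonoid)
import Algebra.Properties.CommutativeMonoid.Sum as CommutativeMonoidSum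
import Algebra.Properties.CommutativeSemigroup as CommutativeSemigroupProperties
open import Data.Empty using (⊥-elim)
open import Data.Fin as Fin using (Fin; zero; suc; _≟_)
import Data.Fin.Properties as FinP
open import Data.Fin.Permutation as Permutation using (Permutation′; _⟨$⟩ʳ_; _⟨$⟩ˡ_)
open import Data.List using (List; []; _∷_; _++_; map; length)
open import Data.List.Properties using (length-map; length-++-sucʳ)
open import Data.List.Membership.Propositional using (_∈_)
open import Data.List.Membership.Propositional.Properties using (∈-++⁻; ∈-++⁺ˡ; ∈-++⁺ʳ; ∈-map⁺; ∈-map⁻; ∈-∃++)
import Data.List.Relation.Unary.All as All
open All using ([]; _∷_)
open import Data.List.Relation.Unary.AllPairs using ([]; _∷_)
open import Data.List.Relation.Unary.Any using (here; there)
open import Data.List.Relation.Unary.Unique.Propositional using (Unique)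
open import Data.Maybe using (just; nothing)
open import Data.Nat using (ℕ; zero; suc; _≤_; z≤n; s≤s; _≤?_)
import Data.Nat.Properties as ℕP
open import Data.Product using (Σ; _×_; _,_; proj₁; proj₂)
open import Data.Product.Properties using (≡-dec; ,-injective)
open import Data.Rational using (ℚ; 0ℚ; 1ℚ; _+_; _*_; _-_; -_; ½; 1/_; NonZero; Positive; NonNegative)
open import Data.Rational.Properties
  using (+-identityˡ; +-identityʳ; *-identityˡ; *-identityʳ; *-zeroˡ; *-zeroʳ; *-comm; *-assoc; +-comm; +-assoc;
         *-distribˡ-+; *-distribʳ-+; *-inverseˡ; pos⇒nonZero; pos+nonNeg⇒pos; pos+pos⇒pos; nonNeg+nonNeg⇒nonNeg;
         +-0-commutativeMonoid; *-1-commutativeMonoid; +-*-commutativeRing)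
open import Data.Sum using (_⊎_; inj₁; inj₂; [_,_])
open import Function using (_∘_; id; case_of_)
open import Function.Bundles using (Equivalence)
open import Function.Definitions using (Congruent)
open import Relation.Binary.PropositionalEquality
  using (_≡_; _≢_; refl; sym; trans; cong; cong₂; subst; subst₂; module ≡-Reasoning)
open import Relation.Nullary using (Dec; yes; no; ¬_; ¬?)
open import Relation.Nullary.Decidable using (_×-dec_; _⊎-dec_; _→-dec_)
open import Tactic.RingSolver using (solve-∀)
open import Tactic.RingSolver.Core.AlmostCommutativeRing using (AlmostCommutativeRing; fromCommutativeRing)

open CommutativeSemigroupProperties (CommutativeMonoid.commutativeSemigroup *-1-commutativeMonoid)
  using (x∙yz≈y∙xz; x∙yz≈yx∙z; xy∙z≈y∙xz)

open ≡-Reasoning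

ℚ-ring : AlmostCommutativeRing 0ℓ 0ℓ
ℚ-ring = fromCommutativeRing +-*-commutativeRing λ x → case x Data.Rational.≟ 0ℚ of λ where
  (yes x≡0) → just (sym x≡0)
  (no _)    → nothing

½*x+½*x≡x : ∀ x → ½ * x + ½ * x ≡ x
½*x+½*x≡x = solve-∀ ℚ-ring

𝟙 : ∀ {p} {P : Set p} → Dec P → ℚ
𝟙 (yes _) = 1ℚ
𝟙 (no _)  = 0ℚ

𝟙-yes : ∀ {p} {P : Set p} (d : Dec P) → P → 𝟙 d ≡ 1ℚ
𝟙-yes (yes _) _ = refl
𝟙-yes (no ¬p) p = ⊥-elim (¬p p)

𝟙-no : ∀ {p} {P : Set p} (d : Dec P) → ¬ P → 𝟙 d ≡ 0ℚ
𝟙-no (yes p) ¬p = ⊥-elim (¬p p)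
𝟙-no (no _)  _  = refl

module _ {p q} {P : Set p} {Q : Set q} where

  𝟙-cong : (d : Dec P) (e : Dec Q) → (P → Q) → (Q → P) → 𝟙 d ≡ 𝟙 e
  𝟙-cong (yes p) e f g = sym (𝟙-yes e (f p))
  𝟙-cong (no ¬p) e f g = sym (𝟙-no e (¬p ∘ g))

  𝟙-× : (d : Dec P) (e : Dec Q) → 𝟙 (d ×-dec e) ≡ 𝟙 d * 𝟙 e
  𝟙-× (yes _) (yes _) = refl
  𝟙-× (yes _) (no _)  = refl
  𝟙-× (no _)  e       = sym (*-zeroˡ (𝟙 e))

  𝟙-⊎ : (d : Dec P) (e : Dec Q) → (P → ¬ Q) → 𝟙 (d ⊎-dec e) ≡ 𝟙 d + 𝟙 e
  𝟙-⊎ (yes p) (yes q) disjoint = ⊥-elim (disjoint p q)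
  𝟙-⊎ (yes _) (no _)  _        = refl
  𝟙-⊎ (no _)  (yes _) _        = refl
  𝟙-⊎ (no _)  (no _)  _        = refl

𝟙-idem : ∀ {p} {P : Set p} (d : Dec P) → 𝟙 d * 𝟙 d ≡ 𝟙 d
𝟙-idem (yes _) = refl
𝟙-idem (no _)  = refl

𝟙-¬?-+ : ∀ {p} {P : Set p} (d : Dec P) → 𝟙 (¬? d) + 𝟙 d ≡ 1ℚ
𝟙-¬?-+ (yes _) = refl
𝟙-¬?-+ (no _)  = refl

𝟙-*-cong : ∀ {p} {P : Set p} (d : Dec P) {x y : ℚ} → (P → x ≡ y) → 𝟙 d * x ≡ 𝟙 d * y
𝟙-*-cong (yes p) x≡y = cong (1ℚ *_) (x≡y p)
𝟙-*-cong (no _) {x} {y} _ = trans (*-zeroˡ x) (sym (*-zeroˡ y))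

δ : ∀ {m} → Fin m → Fin m → ℚ
δ i j = 𝟙 (i ≟ j)

δ≢ : ∀ {m} → Fin m → Fin m → ℚ
δ≢ i j = 𝟙 (¬? (i ≟ j))

δ-comm : ∀ {m} (i j : Fin m) → δ i j ≡ δ j i
δ-comm i j = 𝟙-cong (i ≟ j) (j ≟ i) sym sym

δ≢-comm : ∀ {m} (i j : Fin m) → δ≢ i j ≡ δ≢ j i
δ≢-comm i j = 𝟙-cong (¬? (i ≟ j)) (¬? (j ≟ i)) (_∘ sym) (_∘ sym)

module ∑ℚ = CommutativeMonoidSum +-0-commutativeMonoid

sumFin≡∑ : ∀ {m} (f : Fin m → ℚ) → sumFin f ≡ ∑ℚ.sum f
sumFin≡∑ {zero}  f = refl
sumFin≡∑ {suc m} f = cong (f zero +_) (sumFin≡∑ (f ∘ suc))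

sumFin-cong : ∀ {m} {f g : Fin m → ℚ} → (∀ i → f i ≡ g i) → sumFin f ≡ sumFin g
sumFin-cong {zero}  f≗g = refl
sumFin-cong {suc m} f≗g = cong₂ _+_ (f≗g zero) (sumFin-cong (f≗g ∘ suc))

sumFin-zero : ∀ m → sumFin {m} (λ _ → 0ℚ) ≡ 0ℚ
sumFin-zero zero    = refl
sumFin-zero (suc m) = trans (+-identityˡ _) (sumFin-zero m)

sumFin-+ : ∀ {m} (f g : Fin m → ℚ) → sumFin (λ i → f i + g i) ≡ sumFin f + sumFin g
sumFin-+ f g = begin
  sumFin (λ i → f i + g i)   ≡⟨ sumFin≡∑ (λ i → f i + g i) ⟩
  ∑ℚ.sum (λ i → f i + g i)   ≡⟨ ∑ℚ.∑-distrib-+ f g ⟩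
  ∑ℚ.sum f + ∑ℚ.sum g        ≡⟨ sym (cong₂ _+_ (sumFin≡∑ f) (sumFin≡∑ g)) ⟩
  sumFin f + sumFin g        ∎

sumFin-*ˡ : ∀ {m} (c : ℚ) (f : Fin m → ℚ) → sumFin (λ i → c * f i) ≡ c * sumFin f
sumFin-*ˡ {zero}  c f = sym (*-zeroʳ c)
sumFin-*ˡ {suc m} c f =
  trans (cong (c * f zero +_) (sumFin-*ˡ c (f ∘ suc))) (sym (*-distribˡ-+ c _ _))

sumFin-*ʳ : ∀ {m} (c : ℚ) (f : Fin m → ℚ) → sumFin (λ i → f i * c) ≡ sumFin f * c
sumFin-*ʳ c f =
  trans (sumFin-cong (λ i → *-comm (f i) c)) (trans (sumFin-*ˡ c f) (*-comm c _))

sumFin-comm : ∀ {m k} (f : Fin m → Fin k → ℚ) →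
  sumFin (λ i → sumFin (λ j → f i j)) ≡ sumFin (λ j → sumFin (λ i → f i j))
sumFin-comm f = begin
  sumFin (λ i → sumFin (f i))           ≡⟨ sumFin-cong (λ i → sumFin≡∑ (f i)) ⟩
  sumFin (λ i → ∑ℚ.sum (f i))           ≡⟨ sumFin≡∑ (λ i → ∑ℚ.sum (f i)) ⟩
  ∑ℚ.sum (λ i → ∑ℚ.sum (f i))           ≡⟨ ∑ℚ.∑-comm f ⟩
  ∑ℚ.sum (λ j → ∑ℚ.sum (λ i → f i j))   ≡⟨ sym (sumFin≡∑ (λ j → ∑ℚ.sum (λ i → f i j))) ⟩
  sumFin (λ j → ∑ℚ.sum (λ i → f i j))   ≡⟨ sumFin-cong (λ j → sym (sumFin≡∑ (λ i → f i j))) ⟩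
  sumFin (λ j → sumFin (λ i → f i j))   ∎

sumFin-permute : ∀ {m} (f : Fin m → ℚ) (σ : Permutation′ m) → sumFin f ≡ sumFin (λ i → f (σ ⟨$⟩ʳ i))
sumFin-permute f σ = trans (sumFin≡∑ f) (trans (∑ℚ.∑-permute f σ) (sym (sumFin≡∑ (λ i → f (σ ⟨$⟩ʳ i)))))

sumFin-permuteˡ : ∀ {m} (f : Fin m → ℚ) (σ : Permutation′ m) → sumFin (λ i → f (σ ⟨$⟩ˡ i)) ≡ sumFin f
sumFin-permuteˡ f σ =
  trans (sumFin-permute (λ i → f (σ ⟨$⟩ˡ i)) σ) (sumFin-cong (λ i → cong f (Permutation.inverseˡ σ {i})))

sumFin-δ : ∀ {m} (a : Fin m) (h : Fin m → ℚ) → sumFin (λ i → δ i a * h i) ≡ h a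
sumFin-δ {suc m} zero h = begin
  1ℚ * h zero + sumFin (λ i → 0ℚ * h (suc i))
    ≡⟨ cong₂ _+_ (*-identityˡ (h zero)) (trans (sumFin-cong {m} (λ i → *-zeroˡ (h (suc i)))) (sumFin-zero m)) ⟩
  h zero + 0ℚ  ≡⟨ +-identityʳ (h zero) ⟩
  h zero       ∎
sumFin-δ {suc m} (suc a) h = begin
  0ℚ * h zero + sumFin (λ i → δ (suc i) (suc a) * h (suc i))
    ≡⟨ cong₂ _+_ (*-zeroˡ (h zero)) (sumFin-cong (λ i → cong (_* h (suc i)) (δ-suc {i}))) ⟩
  0ℚ + sumFin (λ i → δ i a * h (suc i))  ≡⟨ +-identityˡ _ ⟩
  sumFin (λ i → δ i a * h (suc i))       ≡⟨ sumFin-δ a (h ∘ suc) ⟩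
  h (suc a)                              ∎
  where
  δ-suc : ∀ {i} → δ (suc i) (suc a) ≡ δ i a
  δ-suc {i} = 𝟙-cong (suc i ≟ suc a) (i ≟ a) FinP.suc-injective (cong suc)

sumFin-δ≢ : ∀ {m} (a : Fin m) (h : Fin m → ℚ) → sumFin (λ b → δ≢ a b * h b) ≡ sumFin h - h a
sumFin-δ≢ a h = begin
  S
    ≡⟨ x≡x+y-y S (h a) ⟩
  S + h a - h a
    ≡⟨ cong (λ t → S + t - h a) (sym (sumFin-δ a h)) ⟩
  S + sumFin (λ b → δ b a * h b) - h a
    ≡⟨ cong (_- h a) (sym (sumFin-+ (λ b → δ≢ a b * h b) (λ b → δ b a * h b))) ⟩
  sumFin (λ b → δ≢ a b * h b + δ b a * h b) - h a
    ≡⟨ cong (_- h a) (sumFin-cong split) ⟩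
  sumFin h - h a ∎
  where
  S = sumFin (λ b → δ≢ a b * h b)
  x≡x+y-y : ∀ x y → x ≡ x + y - y
  x≡x+y-y = solve-∀ ℚ-ring
  split : ∀ b → δ≢ a b * h b + δ b a * h b ≡ h b
  split b = begin
    δ≢ a b * h b + δ b a * h b   ≡⟨ sym (*-distribʳ-+ (h b) (δ≢ a b) (δ b a)) ⟩
    (δ≢ a b + δ b a) * h b       ≡⟨ cong (λ t → (δ≢ a b + t) * h b) (δ-comm b a) ⟩
    (δ≢ a b + δ a b) * h b       ≡⟨ cong (_* h b) (𝟙-¬?-+ (a ≟ b)) ⟩
    1ℚ * h b                     ≡⟨ *-identityˡ (h b) ⟩
    h b                          ∎

sumList-cong : ∀ {A : Set} {f g : A → ℚ} (xs : List A) → (∀ x → x ∈ xs → f x ≡ g x) →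
  sumList f xs ≡ sumList g xs
sumList-cong []       f≗g = refl
sumList-cong (x ∷ xs) f≗g = cong₂ _+_ (f≗g x (here refl)) (sumList-cong xs (λ y → f≗g y ∘ there))

sumList-zero : ∀ {A : Set} (xs : List A) → sumList (λ _ → 0ℚ) xs ≡ 0ℚ
sumList-zero []       = refl
sumList-zero (x ∷ xs) = trans (+-identityˡ _) (sumList-zero xs)

sumList-++ : ∀ {A : Set} (f : A → ℚ) (xs ys : List A) →
  sumList f (xs ++ ys) ≡ sumList f xs + sumList f ys
sumList-++ f []       ys = sym (+-identityˡ _)
sumList-++ f (x ∷ xs) ys = trans (cong (f x +_) (sumList-++ f xs ys)) (sym (+-assoc (f x) _ _))

sumList-map : ∀ {A B : Set} (f : B → ℚ) (h : A → B) (xs : List A) →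
  sumList f (map h xs) ≡ sumList (f ∘ h) xs
sumList-map f h []       = refl
sumList-map f h (x ∷ xs) = cong (f (h x) +_) (sumList-map f h xs)

sumList-*ˡ : ∀ {A : Set} (c : ℚ) (f : A → ℚ) (xs : List A) →
  sumList (λ x → c * f x) xs ≡ c * sumList f xs
sumList-*ˡ c f []       = sym (*-zeroʳ c)
sumList-*ˡ c f (x ∷ xs) = trans (cong (c * f x +_) (sumList-*ˡ c f xs)) (sym (*-distribˡ-+ c _ _))

sumList-*ʳ : ∀ {A : Set} (c : ℚ) (f : A → ℚ) (xs : List A) →
  sumList (λ x → f x * c) xs ≡ sumList f xs * c
sumList-*ʳ c f xs =
  trans (sumList-cong xs (λ x _ → *-comm (f x) c)) (trans (sumList-*ˡ c f xs) (*-comm c _))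

sumFin-sumList : ∀ {A : Set} {m} (f : Fin m → A → ℚ) (xs : List A) →
  sumFin (λ i → sumList (f i) xs) ≡ sumList (λ x → sumFin (λ i → f i x)) xs
sumFin-sumList {m = m} f [] = sumFin-zero m
sumFin-sumList f (x ∷ xs) =
  trans (sumFin-+ (λ i → f i x) _) (cong (sumFin (λ i → f i x) +_) (sumFin-sumList f xs))

⟨$⟩ʳ-injective : ∀ {m} (σ : Permutation′ m) {i j : Fin m} → σ ⟨$⟩ʳ i ≡ σ ⟨$⟩ʳ j → i ≡ j
⟨$⟩ʳ-injective σ eq =
  trans (sym (Permutation.inverseˡ σ)) (trans (cong (σ ⟨$⟩ˡ_) eq) (Permutation.inverseˡ σ))

⟨$⟩ˡ-injective : ∀ {m} (σ : Permutation′ m) {i j : Fin m} → σ ⟨$⟩ˡ i ≡ σ ⟨$⟩ˡ j → i ≡ j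
⟨$⟩ˡ-injective σ eq =
  trans (sym (Permutation.inverseʳ σ)) (trans (cong (σ ⟨$⟩ʳ_) eq) (Permutation.inverseʳ σ))

module _ {m : ℕ} (a b : Fin m) where

  swap-fst : swap a b a ≡ b
  swap-fst with a ≟ a
  ... | yes _   = refl
  ... | no a≢a  = ⊥-elim (a≢a refl)

  swap-snd : swap a b b ≡ a
  swap-snd with b ≟ a
  ... | yes b≡a = b≡a
  ... | no _ with b ≟ b
  ...   | yes _  = refl
  ...   | no b≢b = ⊥-elim (b≢b refl)

  swap-other : ∀ {k} → k ≢ a → k ≢ b → swap a b k ≡ k
  swap-other {k} k≢a k≢b with k ≟ a
  ... | yes k≡a = ⊥-elim (k≢a k≡a)
  ... | no _ with k ≟ b
  ...   | yes k≡b = ⊥-elim (k≢b k≡b)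
  ...   | no _    = refl

swap-comm : ∀ {m} (a b k : Fin m) → swap a b k ≡ swap b a k
swap-comm a b k = cases (k ≟ a) (k ≟ b)
  where
  cases : Dec (k ≡ a) → Dec (k ≡ b) → swap a b k ≡ swap b a k
  cases (yes refl) _          = trans (swap-fst a b) (sym (swap-snd b a))
  cases (no _)     (yes refl) = trans (swap-snd a b) (sym (swap-fst b a))
  cases (no k≢a)   (no k≢b)   = trans (swap-other a b k≢a k≢b) (sym (swap-other b a k≢b k≢a))

swap-conjugate : ∀ {m} (σ : Permutation′ m) (a b i : Fin m) →
  σ ⟨$⟩ˡ swap (σ ⟨$⟩ʳ a) (σ ⟨$⟩ʳ b) i ≡ swap a b (σ ⟨$⟩ˡ i)
swap-conjugate σ a b i = cases (i ≟ σ ⟨$⟩ʳ a) (i ≟ σ ⟨$⟩ʳ b)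
  where
  σ⁻¹ = σ ⟨$⟩ˡ_
  σa = σ ⟨$⟩ʳ a
  σb = σ ⟨$⟩ʳ b
  cases : Dec (i ≡ σa) → Dec (i ≡ σb) → σ⁻¹ (swap σa σb i) ≡ swap a b (σ⁻¹ i)
  cases (yes refl) _ = begin
    σ⁻¹ (swap σa σb σa)   ≡⟨ cong σ⁻¹ (swap-fst σa σb) ⟩
    σ⁻¹ σb                ≡⟨ Permutation.inverseˡ σ ⟩
    b                     ≡⟨ sym (swap-fst a b) ⟩
    swap a b a            ≡⟨ cong (swap a b) (sym (Permutation.inverseˡ σ)) ⟩
    swap a b (σ⁻¹ σa)     ∎
  cases (no _) (yes refl) = begin
    σ⁻¹ (swap σa σb σb)   ≡⟨ cong σ⁻¹ (swap-snd σa σb) ⟩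
    σ⁻¹ σa                ≡⟨ Permutation.inverseˡ σ ⟩
    a                     ≡⟨ sym (swap-snd a b) ⟩
    swap a b b            ≡⟨ cong (swap a b) (sym (Permutation.inverseˡ σ)) ⟩
    swap a b (σ⁻¹ σb)     ∎
  cases (no i≢σa) (no i≢σb) =
    trans (cong σ⁻¹ (swap-other σa σb i≢σa i≢σb)) (sym (swap-other a b (σ⁻¹i≢ i≢σa) (σ⁻¹i≢ i≢σb)))
    where
    σ⁻¹i≢ : ∀ {c} → i ≢ σ ⟨$⟩ʳ c → σ⁻¹ i ≢ c
    σ⁻¹i≢ i≢σc refl = i≢σc (sym (Permutation.inverseʳ σ))

Operator : ℕ → Set
Operator n = Vec' n → Vec' n

record Linear {n} (f : Vec' n → ℚ) : Set where
  constructor linearity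
  field
    linear : ∀ {d} (c : Fin d → ℚ) (v : Fin d → Vec' n) → f (lincomb c v) ≡ sumFin (λ k → c k * f (v k))

open Linear

IsLinear : ∀ {n} → Operator n → Set
IsLinear g = ∀ i j → Linear (λ z → g z i j)

IsCongruent : ∀ {n} → Operator n → Set
IsCongruent g = Congruent _≈V_ _≈V_ g

act : ∀ {n} → Permutation′ n → Operator n
act σ z i j = z (σ ⟨$⟩ˡ i) (σ ⟨$⟩ˡ j)

module _ {n : ℕ} where

  Linear-eval : ∀ a b → Linear {n} (λ z → z a b)
  Linear-eval a b = linearity λ c v → refl

  Linear-+ : {f g : Vec' n → ℚ} → Linear f → Linear g → Linear (λ z → f z + g z)
  Linear-+ {f} {g} f-lin g-lin = linearity λ c v → begin
    f (lincomb c v) + g (lincomb c v)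
      ≡⟨ cong₂ _+_ (linear f-lin c v) (linear g-lin c v) ⟩
    sumFin (λ k → c k * f (v k)) + sumFin (λ k → c k * g (v k))
      ≡⟨ sym (sumFin-+ (λ k → c k * f (v k)) (λ k → c k * g (v k))) ⟩
    sumFin (λ k → c k * f (v k) + c k * g (v k))
      ≡⟨ sumFin-cong (λ k → sym (*-distribˡ-+ (c k) (f (v k)) (g (v k)))) ⟩
    sumFin (λ k → c k * (f (v k) + g (v k))) ∎

  Linear-*ˡ : (s : ℚ) {f : Vec' n → ℚ} → Linear f → Linear (λ z → s * f z)
  Linear-*ˡ s {f} f-lin = linearity λ c v → begin
    s * f (lincomb c v)                  ≡⟨ cong (s *_) (linear f-lin c v) ⟩
    s * sumFin (λ k → c k * f (v k))     ≡⟨ sym (sumFin-*ˡ s (λ k → c k * f (v k))) ⟩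
    sumFin (λ k → s * (c k * f (v k)))   ≡⟨ sumFin-cong (λ k → x∙yz≈y∙xz s (c k) (f (v k))) ⟩
    sumFin (λ k → c k * (s * f (v k)))   ∎

  Linear-sumFin : ∀ {m} {f : Fin m → Vec' n → ℚ} → (∀ i → Linear (f i)) →
    Linear (λ z → sumFin (λ i → f i z))
  Linear-sumFin {f = f} f-lin = linearity λ c v → begin
    sumFin (λ i → f i (lincomb c v))                    ≡⟨ sumFin-cong (λ i → linear (f-lin i) c v) ⟩
    sumFin (λ i → sumFin (λ k → c k * f i (v k)))       ≡⟨ sumFin-comm (λ i k → c k * f i (v k)) ⟩
    sumFin (λ k → sumFin (λ i → c k * f i (v k)))       ≡⟨ sumFin-cong (λ k → sumFin-*ˡ (c k) (λ i → f i (v k))) ⟩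
    sumFin (λ k → c k * sumFin (λ i → f i (v k)))       ∎

  Linear-sumList : ∀ {A : Set} {f : A → Vec' n → ℚ} (xs : List A) → (∀ x → Linear (f x)) →
    Linear (λ z → sumList (λ x → f x z) xs)
  Linear-sumList {f = f} xs f-lin = linearity λ c v → begin
    sumList (λ x → f x (lincomb c v)) xs
      ≡⟨ sumList-cong xs (λ x _ → linear (f-lin x) c v) ⟩
    sumList (λ x → sumFin (λ k → c k * f x (v k))) xs
      ≡⟨ sym (sumFin-sumList (λ k x → c k * f x (v k)) xs) ⟩
    sumFin (λ k → sumList (λ x → c k * f x (v k)) xs)
      ≡⟨ sumFin-cong (λ k → sumList-*ˡ (c k) (λ x → f x (v k)) xs) ⟩
    sumFin (λ k → c k * sumList (λ x → f x (v k)) xs) ∎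

  IsLinear-∘ : {f g : Operator n} → IsCongruent f → IsLinear f → IsLinear g → IsLinear (f ∘ g)
  IsLinear-∘ {f} {g} f-cong f-lin g-lin i j = linearity λ c v →
    trans (f-cong (λ a b → linear (g-lin a b) c v) i j) (linear (f-lin i j) c (g ∘ v))

  _^_ : Operator n → ℕ → Operator n
  (g ^ zero)  z = z
  (g ^ suc r) z = g ((g ^ r) z)

  ^-congruent : ∀ {g} r → IsCongruent g → IsCongruent (g ^ r)
  ^-congruent zero    g-cong z≈z′ = z≈z′
  ^-congruent (suc r) g-cong z≈z′ = g-cong (^-congruent r g-cong z≈z′)

  ^-linear : ∀ {g} r → IsCongruent g → IsLinear g → IsLinear (g ^ r)
  ^-linear zero    g-cong g-lin i j = linearity λ c v → refl
  ^-linear {g} (suc r) g-cong g-lin = IsLinear-∘ {g} {g ^ r} g-cong g-lin (^-linear r g-cong g-lin)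

X-congruent : ∀ {n} (E : EdgeList n) → IsCongruent (X E)
X-congruent E z≈z′ i j = sumList-cong E (λ (a , b) _ → z≈z′ (swap a b i) (swap a b j))

X-linear : ∀ {n} (E : EdgeList n) → IsLinear (X E)
X-linear E i j = Linear-sumList E (λ (a , b) → Linear-eval (swap a b i) (swap a b j))

HasMatrix : ∀ {n d} → Operator n → (Fin d → Vec' n) → Mat d → Set
HasMatrix g b A = ∀ k → g (b k) ≈V lincomb (λ l → A l k) b

module _ {n d : ℕ} (b : Fin d → Vec' n) where

  HasMatrix-identity : HasMatrix (λ z → z) b identity
  HasMatrix-identity k i j = sym (begin
    sumFin (λ l → identity l k * b l i j)   ≡⟨ sumFin-cong (λ l → cong (_* b l i j) (identity≡δ l k)) ⟩
    sumFin (λ l → δ l k * b l i j)          ≡⟨ sumFin-δ k (λ l → b l i j) ⟩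
    b k i j                                 ∎)
    where
    identity≡δ : ∀ l k → identity l k ≡ δ l k
    identity≡δ l k with l ≟ k
    ... | yes _ = refl
    ... | no _  = refl

  HasMatrix-∘ : ∀ {f g : Operator n} {F G : Mat d} → IsCongruent f → IsLinear f →
    HasMatrix f b F → HasMatrix g b G → HasMatrix (f ∘ g) b (matMul F G)
  HasMatrix-∘ {f} {g} {F} {G} f-cong f-lin f-mat g-mat k i j = begin
    f (g (b k)) i j
      ≡⟨ f-cong (g-mat k) i j ⟩
    f (lincomb (λ m → G m k) b) i j
      ≡⟨ linear (f-lin i j) (λ m → G m k) b ⟩
    sumFin (λ m → G m k * f (b m) i j)
      ≡⟨ sumFin-cong (λ m → cong (G m k *_) (f-mat m i j)) ⟩
    sumFin (λ m → G m k * sumFin (λ l → F l m * b l i j))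
      ≡⟨ sumFin-cong (λ m → sym (sumFin-*ˡ (G m k) (λ l → F l m * b l i j))) ⟩
    sumFin (λ m → sumFin (λ l → G m k * (F l m * b l i j)))
      ≡⟨ sumFin-comm (λ m l → G m k * (F l m * b l i j)) ⟩
    sumFin (λ l → sumFin (λ m → G m k * (F l m * b l i j)))
      ≡⟨ sumFin-cong (λ l → sumFin-cong (λ m → x∙yz≈yx∙z (G m k) (F l m) (b l i j))) ⟩
    sumFin (λ l → sumFin (λ m → F l m * G m k * b l i j))
      ≡⟨ sumFin-cong (λ l → sumFin-*ʳ (b l i j) (λ m → F l m * G m k)) ⟩
    sumFin (λ l → matMul F G l k * b l i j) ∎

  HasMatrix-^ : ∀ {g : Operator n} {A : Mat d} → IsCongruent g → IsLinear g → HasMatrix g b A →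
    ∀ r → HasMatrix (g ^ r) b (matPow A r)
  HasMatrix-^ g-cong g-lin g-mat zero    = HasMatrix-identity
  HasMatrix-^ {g} {A} g-cong g-lin g-mat (suc r) =
    HasMatrix-∘ {g} {g ^ r} {A} {matPow A r} g-cong g-lin g-mat (HasMatrix-^ g-cong g-lin g-mat r)

module _ {n : ℕ} where

  rowSum : Vec' n → Fin n → ℚ
  rowSum z a = sumFin (λ b → δ≢ a b * z a b)

  total : Vec' n → ℚ
  total z = sumFin (rowSum z)

-- The summand in InW is a with-function local to Defs and cannot be named;
-- its type is inferred from the uses below, hence the mutual block.
mutual
  private
    InW-summand : ∀ {n} (z : Vec' n) (i j : Fin n) → _ ≡ δ≢ i j * z i j

  InW⇒rowSum≡0 : ∀ {n} {z : Vec' n} → InW z → ∀ i → rowSum z i ≡ 0ℚ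
  InW⇒rowSum≡0 {z = z} z∈W i = trans (sym (sumFin-cong (InW-summand z i))) (z∈W i)

  rowSum≡0⇒InW : ∀ {n} {z : Vec' n} → (∀ i → rowSum z i ≡ 0ℚ) → InW z
  rowSum≡0⇒InW {z = z} rowSum≡0 i = trans (sumFin-cong (InW-summand z i)) (rowSum≡0 i)

  InW-summand z i j with j ≟ i
  ... | yes j≡i = sym (trans (cong (_* z i j) (𝟙-no (¬? (i ≟ j)) (λ i≢j → i≢j (sym j≡i)))) (*-zeroˡ (z i j)))
  ... | no j≢i  = sym (trans (cong (_* z i j) (𝟙-yes (¬? (i ≟ j)) (λ i≡j → j≢i (sym i≡j)))) (*-identityˡ (z i j)))

cardℚ : ℕ → ℚ
cardℚ n = sumFin {n} (λ _ → 1ℚ)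

sumFin-δ≢-count : ∀ {n} (a : Fin n) → sumFin (λ b → δ≢ a b) ≡ cardℚ n - 1ℚ
sumFin-δ≢-count a = trans (sumFin-cong (λ b → sym (*-identityʳ (δ≢ a b)))) (sumFin-δ≢ a (λ _ → 1ℚ))

sumFin₂ : ∀ {m} → (Fin m → Fin m → ℚ) → ℚ
sumFin₂ f = sumFin (λ i → sumFin (λ j → f i j))

sumFin₂-cong : ∀ {m} {f g : Fin m → Fin m → ℚ} → (∀ i j → f i j ≡ g i j) → sumFin₂ f ≡ sumFin₂ g
sumFin₂-cong f≗g = sumFin-cong (λ i → sumFin-cong (f≗g i))

sumFin₂-*ˡ : ∀ {m} (c : ℚ) (f : Fin m → Fin m → ℚ) → sumFin₂ (λ i j → c * f i j) ≡ c * sumFin₂ f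
sumFin₂-*ˡ c f = trans (sumFin-cong (λ i → sumFin-*ˡ c (f i))) (sumFin-*ˡ c (λ i → sumFin (f i)))

sumFin₂-*ʳ : ∀ {m} (c : ℚ) (f : Fin m → Fin m → ℚ) → sumFin₂ (λ i j → f i j * c) ≡ sumFin₂ f * c
sumFin₂-*ʳ c f = trans (sumFin-cong (λ i → sumFin-*ʳ c (f i))) (sumFin-*ʳ c (λ i → sumFin (f i)))

sumFin₂-permute : ∀ {m} (f : Fin m → Fin m → ℚ) (σ : Permutation′ m) →
  sumFin₂ f ≡ sumFin₂ (λ i j → f (σ ⟨$⟩ʳ i) (σ ⟨$⟩ʳ j))
sumFin₂-permute f σ = trans (sumFin-permute (λ i → sumFin (f i)) σ)
                            (sumFin-cong (λ i → sumFin-permute (f (σ ⟨$⟩ʳ i)) σ))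

sumFin₂-sumList : ∀ {A : Set} {m} (f : Fin m → Fin m → A → ℚ) (xs : List A) →
  sumFin₂ (λ a b → sumList (f a b) xs) ≡ sumList (λ x → sumFin₂ (λ a b → f a b x)) xs
sumFin₂-sumList f xs = trans (sumFin-cong (λ a → sumFin-sumList (f a) xs))
                             (sumFin-sumList (λ a x → sumFin (λ b → f a b x)) xs)

sumFin-sumFin₂ : ∀ {m d} (f : Fin d → Fin m → Fin m → ℚ) →
  sumFin (λ k → sumFin₂ (f k)) ≡ sumFin₂ (λ i j → sumFin (λ k → f k i j))
sumFin-sumFin₂ f = trans (sumFin-comm (λ k i → sumFin (f k i)))
                         (sumFin-cong (λ i → sumFin-comm (λ k j → f k i j)))

lincomb₂ : ∀ {n m} → (Fin m → Fin m → ℚ) → (Fin m → Fin m → Vec' n) → Vec' n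
lincomb₂ c v a b = sumFin₂ (λ i j → c i j * v i j a b)

IsLinear-lincomb₂ : ∀ {n m} {g : Operator n} → IsCongruent g → IsLinear g →
  (c : Fin m → Fin m → ℚ) (v : Fin m → Fin m → Vec' n) → g (lincomb₂ c v) ≈V lincomb₂ c (λ i j → g (v i j))
IsLinear-lincomb₂ {m = m} {g} g-cong g-lin c v a b = begin
  g (lincomb₂ c v) a b
    ≡⟨ g-cong (λ a′ b′ → sumFin-cong {m} (λ i → sym (*-identityˡ (lincomb (c i) (v i) a′ b′)))) a b ⟩
  g (lincomb (λ _ → 1ℚ) (λ i → lincomb (c i) (v i))) a b
    ≡⟨ linear (g-lin a b) (λ _ → 1ℚ) (λ i → lincomb (c i) (v i)) ⟩
  sumFin (λ i → 1ℚ * g (lincomb (c i) (v i)) a b)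
    ≡⟨ sumFin-cong (λ i → trans (*-identityˡ _) (linear (g-lin a b) (c i) (v i))) ⟩
  lincomb₂ c (λ i j → g (v i j)) a b ∎

-- For i ≢ j this is the basis vector e_ij of V_n.
basisV : ∀ {n} → Fin n → Fin n → Vec' n
basisV i j a b = δ a i * δ b j + δ a j * δ b i

basisV-symmetric : ∀ {n} (i j a b : Fin n) → basisV i j a b ≡ basisV i j b a
basisV-symmetric i j a b = trans (+-comm (δ a i * δ b j) _) (cong₂ _+_ (*-comm (δ a j) _) (*-comm (δ a i) _))

basisV-transpose : ∀ {n} (i j a b : Fin n) → basisV i j a b ≡ basisV a b i j
basisV-transpose i j a b =
  cong₂ _+_ (cong₂ _*_ (δ-comm a i) (δ-comm b j)) (trans (*-comm (δ a j) _) (cong₂ _*_ (δ-comm b i) (δ-comm a j)))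

sumFin₂-basisV : ∀ {n} (h : Fin n → Fin n → ℚ) (p q : Fin n) →
  sumFin₂ (λ a b → basisV p q a b * h a b) ≡ h p q + h q p
sumFin₂-basisV h p q = begin
  sumFin₂ (λ a b → (δ a p * δ b q + δ a q * δ b p) * h a b)
    ≡⟨ sumFin₂-cong (λ a b → distrib (δ a p) (δ b q) (δ a q) (δ b p) (h a b)) ⟩
  sumFin (λ a → sumFin (λ b → δ a p * (δ b q * h a b) + δ a q * (δ b p * h a b)))
    ≡⟨ sumFin-cong (λ a → trans (sumFin-+ (λ b → δ a p * (δ b q * h a b)) (λ b → δ a q * (δ b p * h a b)))
                                  (cong₂ _+_ (sift a p q) (sift a q p))) ⟩
  sumFin (λ a → δ a p * h a q + δ a q * h a p)
    ≡⟨ trans (sumFin-+ (λ a → δ a p * h a q) (λ a → δ a q * h a p))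
            (cong₂ _+_ (sumFin-δ p (λ a → h a q)) (sumFin-δ q (λ a → h a p))) ⟩
  h p q + h q p ∎
  where
  distrib : ∀ x y u v w → (x * y + u * v) * w ≡ x * (y * w) + u * (v * w)
  distrib = solve-∀ ℚ-ring
  sift : ∀ a p q → sumFin (λ b → δ a p * (δ b q * h a b)) ≡ δ a p * h a q
  sift a p q = trans (sumFin-*ˡ (δ a p) (λ b → δ b q * h a b)) (cong (δ a p *_) (sumFin-δ q (h a)))

basisV-act : ∀ {n} (σ : Permutation′ n) (i j : Fin n) →
  basisV (σ ⟨$⟩ʳ i) (σ ⟨$⟩ʳ j) ≈V act σ (basisV i j)
basisV-act σ i j a b = cong₂ _+_ (cong₂ _*_ (δ-act a i) (δ-act b j)) (cong₂ _*_ (δ-act a j) (δ-act b i))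
  where
  δ-act : ∀ a i → δ a (σ ⟨$⟩ʳ i) ≡ δ (σ ⟨$⟩ˡ a) i
  δ-act a i = 𝟙-cong (a ≟ σ ⟨$⟩ʳ i) (σ ⟨$⟩ˡ a ≟ i)
    (λ a≡σi → trans (cong (σ ⟨$⟩ˡ_) a≡σi) (Permutation.inverseˡ σ))
    (λ σ⁻¹a≡i → trans (sym (Permutation.inverseʳ σ)) (cong (σ ⟨$⟩ʳ_) σ⁻¹a≡i))

-- Traces on W_n from a resolution of the identity

frameTrace : ∀ {n} → (Fin n → Fin n → ℚ) → (Fin n → Fin n → Vec' n) → Operator n → ℚ
frameTrace w P g = sumFin₂ (λ i j → w i j * g (P i j) i j)

frameTrace-conjugate : ∀ {n} (w : Fin n → Fin n → ℚ) (P : Fin n → Fin n → Vec' n) (σ : Permutation′ n) →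
  (∀ i j → w (σ ⟨$⟩ʳ i) (σ ⟨$⟩ʳ j) ≡ w i j) → (∀ i j → P (σ ⟨$⟩ʳ i) (σ ⟨$⟩ʳ j) ≈V act σ (P i j)) →
  ∀ {g h : Operator n} → IsCongruent h → (∀ z → h (act σ z) ≈V act σ (g z)) →
  frameTrace w P h ≡ frameTrace w P g
frameTrace-conjugate w P σ w-invariant P-equivariant {g} {h} h-cong h-conjugate = begin
  sumFin₂ (λ i j → w i j * h (P i j) i j)
    ≡⟨ sumFin₂-permute (λ i j → w i j * h (P i j) i j) σ ⟩
  sumFin₂ (λ i j → w (σ ⟨$⟩ʳ i) (σ ⟨$⟩ʳ j) * h (P (σ ⟨$⟩ʳ i) (σ ⟨$⟩ʳ j)) (σ ⟨$⟩ʳ i) (σ ⟨$⟩ʳ j))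
    ≡⟨ sumFin₂-cong (λ i j → cong₂ _*_ (w-invariant i j) (entry i j)) ⟩
  sumFin₂ (λ i j → w i j * g (P i j) i j) ∎
  where
  entry : ∀ i j → h (P (σ ⟨$⟩ʳ i) (σ ⟨$⟩ʳ j)) (σ ⟨$⟩ʳ i) (σ ⟨$⟩ʳ j) ≡ g (P i j) i j
  entry i j = begin
    h (P (σ ⟨$⟩ʳ i) (σ ⟨$⟩ʳ j)) (σ ⟨$⟩ʳ i) (σ ⟨$⟩ʳ j)
      ≡⟨ h-cong (P-equivariant i j) _ _ ⟩
    h (act σ (P i j)) (σ ⟨$⟩ʳ i) (σ ⟨$⟩ʳ j)
      ≡⟨ h-conjugate (P i j) _ _ ⟩
    g (P i j) (σ ⟨$⟩ˡ (σ ⟨$⟩ʳ i)) (σ ⟨$⟩ˡ (σ ⟨$⟩ʳ j))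
      ≡⟨ cong₂ (g (P i j)) (Permutation.inverseˡ σ) (Permutation.inverseˡ σ) ⟩
    g (P i j) i j ∎

module _ {n d : ℕ} {b : Fin d → Vec' n} (basis : IsBasisW b) where

  private
    independent = proj₁ (proj₂ basis)
    spanning    = proj₂ (proj₂ basis)

  lincomb-injective : ∀ (c c′ : Fin d → ℚ) → lincomb c b ≈V lincomb c′ b → ∀ k → c k ≡ c′ k
  lincomb-injective c c′ c≈c′ k = begin
    c k                  ≡⟨ x≡[x-y]+y (c k) (c′ k) ⟩
    (c k - c′ k) + c′ k  ≡⟨ cong (_+ c′ k) (independent (λ k → c k - c′ k) difference k) ⟩
    0ℚ + c′ k            ≡⟨ +-identityˡ (c′ k) ⟩
    c′ k                 ∎
    where
    x≡[x-y]+y : ∀ x y → x ≡ (x - y) + y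
    x≡[x-y]+y = solve-∀ ℚ-ring
    [x-y]*z : ∀ x y z → (x - y) * z ≡ x * z + - 1ℚ * (y * z)
    [x-y]*z = solve-∀ ℚ-ring
    x-x : ∀ x → x + - 1ℚ * x ≡ 0ℚ
    x-x = solve-∀ ℚ-ring
    difference : lincomb (λ k → c k - c′ k) b ≈V (λ _ _ → 0ℚ)
    difference i j = begin
      sumFin (λ k → (c k - c′ k) * b k i j)
        ≡⟨ sumFin-cong (λ k → [x-y]*z (c k) (c′ k) (b k i j)) ⟩
      sumFin (λ k → c k * b k i j + - 1ℚ * (c′ k * b k i j))
        ≡⟨ trans (sumFin-+ (λ k → c k * b k i j) (λ k → - 1ℚ * (c′ k * b k i j)))
                 (cong (lincomb c b i j +_) (sumFin-*ˡ (- 1ℚ) (λ k → c′ k * b k i j))) ⟩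
      lincomb c b i j + - 1ℚ * lincomb c′ b i j
        ≡⟨ cong (λ t → t + - 1ℚ * lincomb c′ b i j) (c≈c′ i j) ⟩
      lincomb c′ b i j + - 1ℚ * lincomb c′ b i j
        ≡⟨ x-x (lincomb c′ b i j) ⟩
      0ℚ ∎

  module _ (w : Fin n → Fin n → ℚ) (P : Fin n → Fin n → Vec' n)
           (P∈W : ∀ i j → InV (P i j) × InW (P i j))
           (resolution : ∀ {z} → InV z → InW z → lincomb₂ (λ i j → w i j * z i j) P ≈V z) where

    private
      coord : Fin n → Fin n → Fin d → ℚ
      coord i j = proj₁ (spanning (P i j) (proj₁ (P∈W i j)) (proj₂ (P∈W i j)))

      P≈coord : ∀ i j → P i j ≈V lincomb (coord i j) b
      P≈coord i j = proj₂ (spanning (P i j) (proj₁ (P∈W i j)) (proj₂ (P∈W i j)))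

      dual : Fin d → Fin d → ℚ
      dual k l = sumFin₂ (λ i j → w i j * b l i j * coord i j k)

      -- The functionals z ↦ Σ w_ij z_ij coord_ij k are the dual basis of b.
      dual≡δ : ∀ k l → dual k l ≡ δ k l
      dual≡δ k l = lincomb-injective (λ k → dual k l) (λ k → δ k l) expansion k
        where
        expansion : lincomb (λ k → dual k l) b ≈V lincomb (λ k → δ k l) b
        expansion a a′ = begin
          sumFin (λ k → dual k l * b k a a′)
            ≡⟨ sumFin-cong (λ k → sym (sumFin₂-*ʳ (b k a a′) (λ i j → w i j * b l i j * coord i j k))) ⟩
          sumFin (λ k → sumFin₂ (λ i j → w i j * b l i j * coord i j k * b k a a′))
            ≡⟨ sumFin-sumFin₂ (λ k i j → w i j * b l i j * coord i j k * b k a a′) ⟩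
          sumFin₂ (λ i j → sumFin (λ k → w i j * b l i j * coord i j k * b k a a′))
            ≡⟨ sumFin₂-cong (λ i j → trans (sumFin-cong (λ k → *-assoc (w i j * b l i j) (coord i j k) (b k a a′)))
                                            (sumFin-*ˡ (w i j * b l i j) (λ k → coord i j k * b k a a′))) ⟩
          sumFin₂ (λ i j → w i j * b l i j * lincomb (coord i j) b a a′)
            ≡⟨ sumFin₂-cong (λ i j → cong (w i j * b l i j *_) (sym (P≈coord i j a a′))) ⟩
          lincomb₂ (λ i j → w i j * b l i j) P a a′
            ≡⟨ resolution (proj₁ (proj₁ basis l)) (proj₂ (proj₁ basis l)) a a′ ⟩
          b l a a′
            ≡⟨ sym (sumFin-δ l (λ k → b k a a′)) ⟩
          sumFin (λ k → δ k l * b k a a′) ∎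

    trace≡frameTrace : ∀ {g : Operator n} {A : Mat d} → IsCongruent g → IsLinear g → HasMatrix g b A →
      trace A ≡ frameTrace w P g
    trace≡frameTrace {g} {A} g-cong g-lin g-mat = sym (begin
      sumFin₂ (λ i j → w i j * g (P i j) i j)
        ≡⟨ sumFin₂-cong (λ i j → cong (w i j *_) (expand i j)) ⟩
      sumFin₂ (λ i j → w i j * sumFin (λ k → coord i j k * sumFin (λ l → A l k * b l i j)))
        ≡⟨ sumFin₂-cong distribute ⟩
      sumFin₂ (λ i j → sumFin (λ k → sumFin (λ l → A l k * (w i j * b l i j * coord i j k))))
        ≡⟨ sym (sumFin-sumFin₂ (λ k i j → sumFin (λ l → A l k * (w i j * b l i j * coord i j k)))) ⟩
      sumFin (λ k → sumFin₂ (λ i j → sumFin (λ l → A l k * (w i j * b l i j * coord i j k))))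
        ≡⟨ sumFin-cong (λ k → sym (sumFin-sumFin₂ (λ l i j → A l k * (w i j * b l i j * coord i j k)))) ⟩
      sumFin (λ k → sumFin (λ l → sumFin₂ (λ i j → A l k * (w i j * b l i j * coord i j k))))
        ≡⟨ sumFin-cong (λ k → sumFin-cong (λ l → trans (sumFin₂-*ˡ (A l k) (λ i j → w i j * b l i j * coord i j k))
                                                       (cong (A l k *_) (trans (dual≡δ k l) (δ-comm k l))))) ⟩
      sumFin (λ k → sumFin (λ l → A l k * δ l k))
        ≡⟨ sumFin-cong (λ k → trans (sumFin-cong (λ l → *-comm (A l k) (δ l k))) (sumFin-δ k (λ l → A l k))) ⟩
      sumFin (λ k → A k k) ∎)
      where
      expand : ∀ i j → g (P i j) i j ≡ sumFin (λ k → coord i j k * sumFin (λ l → A l k * b l i j))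
      expand i j = begin
        g (P i j) i j                             ≡⟨ g-cong (P≈coord i j) i j ⟩
        g (lincomb (coord i j) b) i j             ≡⟨ linear (g-lin i j) (coord i j) b ⟩
        sumFin (λ k → coord i j k * g (b k) i j)  ≡⟨ sumFin-cong (λ k → cong (coord i j k *_) (g-mat k i j)) ⟩
        sumFin (λ k → coord i j k * sumFin (λ l → A l k * b l i j)) ∎
      rearrange : ∀ x y a v → x * (y * (a * v)) ≡ a * (x * v * y)
      rearrange = solve-∀ ℚ-ring
      distribute : ∀ i j → w i j * sumFin (λ k → coord i j k * sumFin (λ l → A l k * b l i j)) ≡
                           sumFin (λ k → sumFin (λ l → A l k * (w i j * b l i j * coord i j k)))
      distribute i j = trans (sym (sumFin-*ˡ (w i j) (λ k → coord i j k * sumFin (λ l → A l k * b l i j))))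
                             (sumFin-cong distribute-k)
        where
        distribute-k : ∀ k → w i j * (coord i j k * sumFin (λ l → A l k * b l i j)) ≡
                             sumFin (λ l → A l k * (w i j * b l i j * coord i j k))
        distribute-k k = begin
          w i j * (coord i j k * sumFin (λ l → A l k * b l i j))
            ≡⟨ cong (w i j *_) (sym (sumFin-*ˡ (coord i j k) (λ l → A l k * b l i j))) ⟩
          w i j * sumFin (λ l → coord i j k * (A l k * b l i j))
            ≡⟨ sym (sumFin-*ˡ (w i j) (λ l → coord i j k * (A l k * b l i j))) ⟩
          sumFin (λ l → w i j * (coord i j k * (A l k * b l i j)))
            ≡⟨ sumFin-cong (λ l → rearrange (w i j) (coord i j k) (A l k) (b l i j)) ⟩
          sumFin (λ l → A l k * (w i j * b l i j * coord i j k)) ∎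

-- The projection of V_n onto W_n

_≈off_ : ∀ {n} → Vec' n → Vec' n → Set
z ≈off z′ = ∀ a b → a ≢ b → z a b ≡ z′ a b

module Projection {n : ℕ} (α β : ℚ) where

  centred : Operator n
  centred z a b = z a b + - α * (rowSum z a + rowSum z b) + β * total z

  π : Operator n
  π z a b = δ≢ a b * centred z a b

  rowSum-linear : ∀ (a : Fin n) → Linear (λ z → rowSum z a)
  rowSum-linear a = Linear-sumFin (λ b → Linear-*ˡ (δ≢ a b) (Linear-eval a b))

  total-linear : Linear {n} total
  total-linear = Linear-sumFin rowSum-linear

  π-linear : IsLinear π
  π-linear a b = Linear-*ˡ (δ≢ a b)
    (Linear-+ (Linear-+ (Linear-eval a b) (Linear-*ˡ (- α) (Linear-+ (rowSum-linear a) (rowSum-linear b))))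
              (Linear-*ˡ β total-linear))

  rowSum-cong-off : ∀ {z z′ : Vec' n} → z ≈off z′ → ∀ a → rowSum z a ≡ rowSum z′ a
  rowSum-cong-off z≈z′ a = sumFin-cong (λ b → 𝟙-*-cong (¬? (a ≟ b)) (z≈z′ a b))

  π-cong-off : ∀ {z z′ : Vec' n} → z ≈off z′ → π z ≈V π z′
  π-cong-off z≈z′ a b = 𝟙-*-cong (¬? (a ≟ b)) λ a≢b →
    cong₂ _+_ (cong₂ _+_ (z≈z′ a b a≢b) (cong (- α *_) (cong₂ _+_ (rowSum≡ a) (rowSum≡ b))))
              (cong (β *_) (sumFin-cong rowSum≡))
    where rowSum≡ = rowSum-cong-off z≈z′

  π-congruent : IsCongruent π
  π-congruent z≈z′ = π-cong-off (λ a b _ → z≈z′ a b)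

  π-symmetric : ∀ {z : Vec' n} → (∀ a b → z a b ≡ z b a) → ∀ a b → π z a b ≡ π z b a
  π-symmetric {z} z-sym a b = cong₂ _*_ (δ≢-comm a b)
    (cong (_+ β * total z) (cong₂ _+_ (z-sym a b) (cong (- α *_) (+-comm (rowSum z a) (rowSum z b)))))

  π-diagonal : ∀ (z : Vec' n) a → π z a a ≡ 0ℚ
  π-diagonal z a = trans (cong (_* centred z a a) (𝟙-no (¬? (a ≟ a)) (λ a≢a → a≢a refl))) (*-zeroˡ (centred z a a))

  module _ (σ : Permutation′ n) where

    δ≢-act : ∀ a b → δ≢ (σ ⟨$⟩ˡ a) (σ ⟨$⟩ˡ b) ≡ δ≢ a b
    δ≢-act a b = 𝟙-cong (¬? ((σ ⟨$⟩ˡ a) ≟ (σ ⟨$⟩ˡ b))) (¬? (a ≟ b))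
      (λ σa≢σb a≡b → σa≢σb (cong (σ ⟨$⟩ˡ_) a≡b)) (λ a≢b σa≡σb → a≢b (⟨$⟩ˡ-injective σ σa≡σb))

    rowSum-act : ∀ z a → rowSum (act σ z) a ≡ rowSum z (σ ⟨$⟩ˡ a)
    rowSum-act z a = begin
      sumFin (λ b → δ≢ a b * z (σ ⟨$⟩ˡ a) (σ ⟨$⟩ˡ b))
        ≡⟨ sumFin-cong (λ b → cong (_* z (σ ⟨$⟩ˡ a) (σ ⟨$⟩ˡ b)) (sym (δ≢-act a b))) ⟩
      sumFin (λ b → δ≢ (σ ⟨$⟩ˡ a) (σ ⟨$⟩ˡ b) * z (σ ⟨$⟩ˡ a) (σ ⟨$⟩ˡ b))
        ≡⟨ sumFin-permuteˡ (λ c → δ≢ (σ ⟨$⟩ˡ a) c * z (σ ⟨$⟩ˡ a) c) σ ⟩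
      rowSum z (σ ⟨$⟩ˡ a) ∎

    total-act : ∀ z → total (act σ z) ≡ total z
    total-act z = trans (sumFin-cong (rowSum-act z)) (sumFin-permuteˡ (rowSum z) σ)

    π-act : ∀ z → π (act σ z) ≈V act σ (π z)
    π-act z a b = cong₂ _*_ (sym (δ≢-act a b))
      (cong₂ _+_ (cong (z (σ ⟨$⟩ˡ a) (σ ⟨$⟩ˡ b) +_) (cong (- α *_) (cong₂ _+_ (rowSum-act z a) (rowSum-act z b))))
                 (cong (β *_) (total-act z)))

  -- The row sums of π z are rowSum z a (1 - α (n - 2)) + total z (β (n - 1) - α).
  module OntoW (α-eq : α * (cardℚ n - 1ℚ - 1ℚ) ≡ 1ℚ) (β-eq : β * (cardℚ n - 1ℚ) ≡ α) where

    rowSum-π : ∀ z a → rowSum (π z) a ≡ 0ℚ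
    rowSum-π z a = begin
      sumFin (λ b → δ≢ a b * (δ≢ a b * centred z a b))
        ≡⟨ sumFin-cong (λ b → trans (sym (*-assoc (δ≢ a b) _ _)) (cong (_* centred z a b) (𝟙-idem (¬? (a ≟ b))))) ⟩
      sumFin (λ b → δ≢ a b * centred z a b)
        ≡⟨ sumFin-cong (λ b → expand (δ≢ a b) (z a b) (rowSum z b) R T α β) ⟩
      sumFin (λ b → δ≢ a b * z a b + (δ≢ a b * c + - α * (δ≢ a b * rowSum z b)))
        ≡⟨ trans (sumFin-+ (λ b → δ≢ a b * z a b) _) (cong (R +_) (sumFin-+ (λ b → δ≢ a b * c) _)) ⟩
      R + (sumFin (λ b → δ≢ a b * c) + sumFin (λ b → - α * (δ≢ a b * rowSum z b)))
        ≡⟨ cong (R +_) (cong₂ _+_ (trans (sumFin-*ʳ c (δ≢ a)) (cong (_* c) (sumFin-δ≢-count a)))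
                                   (trans (sumFin-*ˡ (- α) (λ b → δ≢ a b * rowSum z b))
                                          (cong (- α *_) (sumFin-δ≢ a (rowSum z))))) ⟩
      R + ((cardℚ n - 1ℚ) * c + - α * (T - R))
        ≡⟨ collect R T (cardℚ n - 1ℚ) α β ⟩
      R * (1ℚ - α * (cardℚ n - 1ℚ - 1ℚ)) + T * (β * (cardℚ n - 1ℚ) - α)
        ≡⟨ cong₂ (λ x y → R * (1ℚ - x) + T * (y - α)) α-eq β-eq ⟩
      R * (1ℚ - 1ℚ) + T * (α - α)
        ≡⟨ vanish R T α ⟩
      0ℚ ∎
      where
      R = rowSum z a
      T = total z
      c = - α * R + β * T
      expand : ∀ d x r R T α β → d * (x + - α * (R + r) + β * T) ≡ d * x + (d * (- α * R + β * T) + - α * (d * r))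
      expand = solve-∀ ℚ-ring
      collect : ∀ R T K α β →
        R + (K * (- α * R + β * T) + - α * (T - R)) ≡ R * (1ℚ - α * (K - 1ℚ)) + T * (β * K - α)
      collect = solve-∀ ℚ-ring
      vanish : ∀ x y w → x * (1ℚ - 1ℚ) + y * (w - w) ≡ 0ℚ
      vanish = solve-∀ ℚ-ring

    π-fixes-W : ∀ {z : Vec' n} → InV z → InW z → π z ≈V z
    π-fixes-W {z} (z-sym , z-diag) z∈W a b = begin
      δ≢ a b * (z a b + - α * (rowSum z a + rowSum z b) + β * total z)
        ≡⟨ cong₂ (λ x y → δ≢ a b * (z a b + - α * x + β * y))
                 (cong₂ _+_ (rowSum≡0 a) (rowSum≡0 b)) (trans (sumFin-cong rowSum≡0) (sumFin-zero n)) ⟩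
      δ≢ a b * (z a b + - α * (0ℚ + 0ℚ) + β * 0ℚ)
        ≡⟨ cong (δ≢ a b *_) (drop (z a b) α β) ⟩
      δ≢ a b * z a b
        ≡⟨ off-diagonal (a ≟ b) ⟩
      z a b ∎
      where
      rowSum≡0 = InW⇒rowSum≡0 z∈W
      drop : ∀ x y w → x + - y * (0ℚ + 0ℚ) + w * 0ℚ ≡ x
      drop = solve-∀ ℚ-ring
      off-diagonal : Dec (a ≡ b) → δ≢ a b * z a b ≡ z a b
      off-diagonal (yes refl) = trans (cong (_* z a a) (𝟙-no (¬? (a ≟ a)) (λ a≢a → a≢a refl)))
                                      (trans (*-zeroˡ (z a a)) (sym (z-diag a)))
      off-diagonal (no a≢b)   = trans (cong (_* z a b) (𝟙-yes (¬? (a ≟ b)) a≢b)) (*-identityˡ (z a b))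

    weight : Fin n → Fin n → ℚ
    weight i j = ½ * δ≢ i j

    frame : Fin n → Fin n → Vec' n
    frame i j = π (basisV i j)

    frame∈W : ∀ i j → InV (frame i j) × InW (frame i j)
    frame∈W i j = (π-symmetric (basisV-symmetric i j) , π-diagonal (basisV i j)) ,
                  rowSum≡0⇒InW (rowSum-π (basisV i j))

    basisV-expansion : ∀ {z : Vec' n} → (∀ a b → z a b ≡ z b a) →
      lincomb₂ (λ i j → weight i j * z i j) basisV ≈off z
    basisV-expansion {z} z-sym a b a≢b = begin
      sumFin₂ (λ i j → W i j * basisV i j a b)
        ≡⟨ sumFin₂-cong (λ i j → trans (*-comm (W i j) _) (cong (_* W i j) (basisV-transpose i j a b))) ⟩
      sumFin₂ (λ i j → basisV a b i j * W i j)
        ≡⟨ sumFin₂-basisV W a b ⟩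
      ½ * δ≢ a b * z a b + ½ * δ≢ b a * z b a
        ≡⟨ cong₂ (λ x y → ½ * x * z a b + ½ * y * z b a)
                 (𝟙-yes (¬? (a ≟ b)) a≢b) (𝟙-yes (¬? (b ≟ a)) (a≢b ∘ sym)) ⟩
      ½ * z a b + ½ * z b a
        ≡⟨ cong (λ t → ½ * z a b + ½ * t) (sym (z-sym a b)) ⟩
      ½ * z a b + ½ * z a b
        ≡⟨ ½*x+½*x≡x (z a b) ⟩
      z a b ∎
      where
      W : Fin n → Fin n → ℚ
      W i j = weight i j * z i j

    resolution : ∀ {z : Vec' n} → InV z → InW z → lincomb₂ (λ i j → weight i j * z i j) frame ≈V z
    resolution {z} z∈V z∈W a b = begin
      lincomb₂ c frame a b       ≡⟨ sym (IsLinear-lincomb₂ π-congruent π-linear c basisV a b) ⟩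
      π (lincomb₂ c basisV) a b  ≡⟨ π-cong-off (basisV-expansion (proj₁ z∈V)) a b ⟩
      π z a b                    ≡⟨ π-fixes-W z∈V z∈W a b ⟩
      z a b                      ∎
      where
      c : Fin n → Fin n → ℚ
      c i j = weight i j * z i j

    weight-act : ∀ (σ : Permutation′ n) i j → weight (σ ⟨$⟩ʳ i) (σ ⟨$⟩ʳ j) ≡ weight i j
    weight-act σ i j = cong (½ *_) (𝟙-cong (¬? (σ ⟨$⟩ʳ i ≟ σ ⟨$⟩ʳ j)) (¬? (i ≟ j))
      (λ σi≢σj i≡j → σi≢σj (cong (σ ⟨$⟩ʳ_) i≡j)) (λ i≢j σi≡σj → i≢j (⟨$⟩ʳ-injective σ σi≡σj)))

    frame-act : ∀ (σ : Permutation′ n) i j → frame (σ ⟨$⟩ʳ i) (σ ⟨$⟩ʳ j) ≈V act σ (frame i j)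
    frame-act σ i j a b = trans (π-congruent (basisV-act σ i j) a b) (π-act σ (basisV i j) a b)

Word : ℕ → Set
Word n = List (Fin n × Fin n)

sumWords : ∀ {n} → ℕ → (Word n → ℚ) → ℚ
sumWords zero    F = F []
sumWords (suc r) F = sumFin₂ (λ a b → sumWords r (λ w → F ((a , b) ∷ w)))

actWord : ∀ {n} → Word n → Operator n
actWord []            z = z
actWord ((a , b) ∷ w) z = actSwap a b (actWord w z)

relabelLetter : ∀ {n} → Permutation′ n → Fin n × Fin n → Fin n × Fin n
relabelLetter σ (a , b) = σ ⟨$⟩ʳ a , σ ⟨$⟩ʳ b

relabel : ∀ {n} → Permutation′ n → Word n → Word n
relabel σ = map (relabelLetter σ)

module _ {n : ℕ} where

  sumWords-cong : ∀ r {F G : Word n → ℚ} → (∀ w → length w ≡ r → F w ≡ G w) → sumWords r F ≡ sumWords r G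
  sumWords-cong zero    F≗G = F≗G [] refl
  sumWords-cong (suc r) F≗G =
    sumFin₂-cong (λ a b → sumWords-cong r (λ w |w|≡r → F≗G ((a , b) ∷ w) (cong suc |w|≡r)))

  sumWords-*ˡ : ∀ r (c : ℚ) (F : Word n → ℚ) → sumWords r (λ w → c * F w) ≡ c * sumWords r F
  sumWords-*ˡ zero    c F = refl
  sumWords-*ˡ (suc r) c F = trans (sumFin₂-cong (λ a b → sumWords-*ˡ r c (λ w → F ((a , b) ∷ w))))
                                    (sumFin₂-*ˡ c (λ a b → sumWords r (λ w → F ((a , b) ∷ w))))

  sumWords-zero : ∀ r → sumWords {n} r (λ _ → 0ℚ) ≡ 0ℚ
  sumWords-zero zero    = refl
  sumWords-zero (suc r) =
    trans (sumFin₂-cong {n} (λ _ _ → sumWords-zero r))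
          (trans (sumFin-cong {n} (λ _ → sumFin-zero n)) (sumFin-zero n))

  sumFin-sumWords : ∀ {m} r (F : Fin m → Word n → ℚ) →
    sumFin (λ i → sumWords r (F i)) ≡ sumWords r (λ w → sumFin (λ i → F i w))
  sumFin-sumWords zero    F = refl
  sumFin-sumWords (suc r) F = begin
    sumFin (λ i → sumFin₂ (λ a b → sumWords r (λ w → F i ((a , b) ∷ w))))
      ≡⟨ sumFin-sumFin₂ (λ i a b → sumWords r (λ w → F i ((a , b) ∷ w))) ⟩
    sumFin₂ (λ a b → sumFin (λ i → sumWords r (λ w → F i ((a , b) ∷ w))))
      ≡⟨ sumFin₂-cong (λ a b → sumFin-sumWords r (λ i w → F i ((a , b) ∷ w))) ⟩
    sumWords (suc r) (λ w → sumFin (λ i → F i w)) ∎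

  sumFin₂-sumWords : ∀ {m} r (F : Fin m → Fin m → Word n → ℚ) →
    sumFin₂ (λ i j → sumWords r (F i j)) ≡ sumWords r (λ w → sumFin₂ (λ i j → F i j w))
  sumFin₂-sumWords r F = trans (sumFin-cong (λ i → sumFin-sumWords r (F i)))
                               (sumFin-sumWords r (λ i w → sumFin (λ j → F i j w)))

  sumList-sumWords : ∀ {A : Set} r (F : A → Word n → ℚ) (xs : List A) →
    sumList (λ x → sumWords r (F x)) xs ≡ sumWords r (λ w → sumList (λ x → F x w) xs)
  sumList-sumWords zero    F xs = refl
  sumList-sumWords (suc r) F xs = begin
    sumList (λ x → sumFin₂ (λ a b → sumWords r (λ w → F x ((a , b) ∷ w)))) xs
      ≡⟨ sym (sumFin-sumList (λ a x → sumFin (λ b → sumWords r (λ w → F x ((a , b) ∷ w)))) xs) ⟩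
    sumFin (λ a → sumList (λ x → sumFin (λ b → sumWords r (λ w → F x ((a , b) ∷ w)))) xs)
      ≡⟨ sumFin-cong (λ a → sym (sumFin-sumList (λ b x → sumWords r (λ w → F x ((a , b) ∷ w))) xs)) ⟩
    sumFin₂ (λ a b → sumList (λ x → sumWords r (λ w → F x ((a , b) ∷ w))) xs)
      ≡⟨ sumFin₂-cong (λ a b → sumList-sumWords r (λ x w → F x ((a , b) ∷ w)) xs) ⟩
    sumWords (suc r) (λ w → sumList (λ x → F x w) xs) ∎

  sumWords-relabel : ∀ r (σ : Permutation′ n) (F : Word n → ℚ) → sumWords r F ≡ sumWords r (F ∘ relabel σ)
  sumWords-relabel zero    σ F = refl
  sumWords-relabel (suc r) σ F = begin
    sumFin₂ (λ a b → sumWords r (λ w → F ((a , b) ∷ w)))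
      ≡⟨ sumFin₂-permute (λ a b → sumWords r (λ w → F ((a , b) ∷ w))) σ ⟩
    sumFin₂ (λ a b → sumWords r (λ w → F ((σ ⟨$⟩ʳ a , σ ⟨$⟩ʳ b) ∷ w)))
      ≡⟨ sumFin₂-cong (λ a b → sumWords-relabel r σ (λ w → F ((σ ⟨$⟩ʳ a , σ ⟨$⟩ʳ b) ∷ w))) ⟩
    sumWords (suc r) (F ∘ relabel σ) ∎

  actWord-congruent : ∀ w → IsCongruent (actWord {n} w)
  actWord-congruent []            z≈z′ = z≈z′
  actWord-congruent ((a , b) ∷ w) z≈z′ i j = actWord-congruent w z≈z′ (swap a b i) (swap a b j)

  actWord-relabel : ∀ (σ : Permutation′ n) w z → actWord (relabel σ w) (act σ z) ≈V act σ (actWord w z)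
  actWord-relabel σ []            z i j = refl
  actWord-relabel σ ((a , b) ∷ w) z i j = trans (actWord-relabel σ w z _ _)
    (cong₂ (actWord w z) (swap-conjugate σ a b i) (swap-conjugate σ a b j))

adjacencyCount : ∀ {n} → EdgeList n → Fin n → Fin n → ℚ
adjacencyCount E a b = sumList (λ (p , q) → basisV p q a b) E

½^ : ℕ → ℚ
½^ zero    = 1ℚ
½^ (suc r) = ½ * ½^ r

wordWeight : ∀ {n} → EdgeList n → Word n → ℚ
wordWeight E []            = 1ℚ
wordWeight E ((a , b) ∷ w) = ½ * adjacencyCount E a b * wordWeight E w

-- A sum over ordered pairs meets each edge twice, hence the factor ½.
sumList-edges : ∀ {n} (E : EdgeList n) (h : Fin n → Fin n → ℚ) → (∀ a b → h a b ≡ h b a) →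
  sumList (λ (p , q) → h p q) E ≡ sumFin₂ (λ a b → ½ * adjacencyCount E a b * h a b)
sumList-edges E h h-sym = sym (begin
  sumFin₂ (λ a b → ½ * adjacencyCount E a b * h a b)
    ≡⟨ sumFin₂-cong (λ a b → trans (xy∙z≈y∙xz ½ (adjacencyCount E a b) (h a b))
                                   (sym (sumList-*ʳ (½ * h a b) (λ (p , q) → basisV p q a b) E))) ⟩
  sumFin₂ (λ a b → sumList (λ (p , q) → basisV p q a b * (½ * h a b)) E)
    ≡⟨ sumFin₂-sumList (λ a b (p , q) → basisV p q a b * (½ * h a b)) E ⟩
  sumList (λ (p , q) → sumFin₂ (λ a b → basisV p q a b * (½ * h a b))) E
    ≡⟨ sumList-cong E (λ (p , q) _ → begin
         sumFin₂ (λ a b → basisV p q a b * (½ * h a b))  ≡⟨ sumFin₂-basisV (λ a b → ½ * h a b) p q ⟩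
         ½ * h p q + ½ * h q p                          ≡⟨ cong (λ t → ½ * h p q + ½ * t) (sym (h-sym p q)) ⟩
         ½ * h p q + ½ * h p q                          ≡⟨ ½*x+½*x≡x (h p q) ⟩
         h p q                                          ∎) ⟩
  sumList (λ (p , q) → h p q) E ∎)

X^-expansion : ∀ {n} (E : EdgeList n) r (z : Vec' n) i j →
  (X E ^ r) z i j ≡ sumWords r (λ w → wordWeight E w * actWord w z i j)
X^-expansion E zero    z i j = sym (*-identityˡ (z i j))
X^-expansion E (suc r) z i j = begin
  sumList (λ (a , b) → Y (swap a b i) (swap a b j)) E
    ≡⟨ sumList-edges E (λ a b → Y (swap a b i) (swap a b j))
                       (λ a b → cong₂ Y (swap-comm a b i) (swap-comm a b j)) ⟩
  sumFin₂ (λ a b → c a b * Y (swap a b i) (swap a b j))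
    ≡⟨ sumFin₂-cong (λ a b → trans (cong (c a b *_) (X^-expansion E r z (swap a b i) (swap a b j)))
                                   (sym (sumWords-*ˡ r (c a b) _))) ⟩
  sumFin₂ (λ a b → sumWords r (λ w → c a b * (wordWeight E w * actWord w z (swap a b i) (swap a b j))))
    ≡⟨ sumFin₂-cong (λ a b → sumWords-cong r (λ w _ → sym (*-assoc (c a b) _ _))) ⟩
  sumWords (suc r) (λ w → wordWeight E w * actWord w z i j) ∎
  where
  Y = (X E ^ r) z
  c : Fin _ → Fin _ → ℚ
  c a b = ½ * adjacencyCount E a b

frameTrace-X^ : ∀ {n} (E : EdgeList n) r (w : Fin n → Fin n → ℚ) (P : Fin n → Fin n → Vec' n) →
  frameTrace w P (X E ^ r) ≡ sumWords r (λ u → wordWeight E u * frameTrace w P (actWord u))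
frameTrace-X^ E r w P = begin
  sumFin₂ (λ i j → w i j * (X E ^ r) (P i j) i j)
    ≡⟨ sumFin₂-cong (λ i j → trans (cong (w i j *_) (X^-expansion E r (P i j) i j))
                                   (sym (sumWords-*ˡ r (w i j) _))) ⟩
  sumFin₂ (λ i j → sumWords r (λ u → w i j * (wordWeight E u * actWord u (P i j) i j)))
    ≡⟨ sumFin₂-sumWords r (λ i j u → w i j * (wordWeight E u * actWord u (P i j) i j)) ⟩
  sumWords r (λ u → sumFin₂ (λ i j → w i j * (wordWeight E u * actWord u (P i j) i j)))
    ≡⟨ sumWords-cong r (λ u _ → trans (sumFin₂-cong (λ i j → x∙yz≈y∙xz (w i j) (wordWeight E u) _))
                                      (sumFin₂-*ˡ (wordWeight E u) (λ i j → w i j * actWord u (P i j) i j))) ⟩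
  sumWords r (λ u → wordWeight E u * frameTrace w P (actWord u)) ∎

module _ {A : Set} where

  subsets-⊆ : ∀ (xs : List A) {ys} → ys ∈ subsets xs → ∀ {y} → y ∈ ys → y ∈ xs
  subsets-⊆ []       (here refl) ()
  subsets-⊆ (x ∷ xs) ys∈ y∈ with ∈-++⁻ (subsets xs) ys∈
  ... | inj₁ ys∈′ = there (subsets-⊆ xs ys∈′ y∈)
  ... | inj₂ ys∈′ with ∈-map⁻ (x ∷_) ys∈′
  ...   | zs , zs∈ , refl with y∈
  ...     | here y≡x   = here y≡x
  ...     | there y∈zs = there (subsets-⊆ xs zs∈ y∈zs)

  subsets-Unique : ∀ {xs : List A} → Unique xs → ∀ {ys} → ys ∈ subsets xs → Unique ys
  subsets-Unique {[]}     []                (here refl) = []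
  subsets-Unique {x ∷ xs} (x∉xs ∷ xs-unique) ys∈ with ∈-++⁻ (subsets xs) ys∈
  ... | inj₁ ys∈′ = subsets-Unique xs-unique ys∈′
  ... | inj₂ ys∈′ with ∈-map⁻ (x ∷_) ys∈′
  ...   | zs , zs∈ , refl =
    All.tabulate (λ y∈zs → All.lookup x∉xs (subsets-⊆ xs zs∈ y∈zs)) ∷ subsets-Unique xs-unique zs∈

  sumList-subsets-∷ : ∀ (f : List A → ℚ) x xs →
    sumList f (subsets (x ∷ xs)) ≡ sumList f (subsets xs) + sumList (λ ys → f (x ∷ ys)) (subsets xs)
  sumList-subsets-∷ f x xs =
    trans (sumList-++ f (subsets xs) (map (x ∷_) (subsets xs)))
          (cong (sumList f (subsets xs) +_) (sumList-map f (x ∷_) (subsets xs)))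

  Unique-⊆⇒length-≤ : ∀ {xs ys : List A} → Unique xs → (∀ {x} → x ∈ xs → x ∈ ys) → length xs ≤ length ys
  Unique-⊆⇒length-≤ {[]}     _                  _    = z≤n
  Unique-⊆⇒length-≤ {x ∷ xs} {ys} (x∉xs ∷ xs-unique) xs⊆ys with ∈-∃++ (xs⊆ys (here refl))
  ... | ys₁ , ys₂ , refl =
    ℕP.≤-trans (s≤s (Unique-⊆⇒length-≤ xs-unique xs⊆ys₁++ys₂)) (ℕP.≤-reflexive (sym (length-++-sucʳ ys₁ x ys₂)))
    where
    xs⊆ys₁++ys₂ : ∀ {y} → y ∈ xs → y ∈ ys₁ ++ ys₂
    xs⊆ys₁++ys₂ {y} y∈xs with ∈-++⁻ ys₁ (xs⊆ys (there y∈xs))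
    ... | inj₁ y∈ys₁         = ∈-++⁺ˡ y∈ys₁
    ... | inj₂ (here y≡x)    = ⊥-elim (All.lookup x∉xs y∈xs (sym y≡x))
    ... | inj₂ (there y∈ys₂) = ∈-++⁺ʳ ys₁ y∈ys₂

module _ {n : ℕ} where

  _≟ₑ_ : (x y : Fin n × Fin n) → Dec (x ≡ y)
  _≟ₑ_ = ≡-dec _≟_ _≟_

  Adj? : ∀ (E : EdgeList n) a b → Dec (Adj E a b)
  Adj? E a b = ((a , b) ∈? E) ⊎-dec ((b , a) ∈? E)
    where open import Data.List.Membership.DecPropositional _≟ₑ_ using (_∈?_)

  Adj-sym : ∀ {E : EdgeList n} {a b} → Adj E a b → Adj E b a
  Adj-sym (inj₁ ab∈E) = inj₂ ab∈E
  Adj-sym (inj₂ ba∈E) = inj₁ ba∈E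

  Adj-mono : ∀ {S E : EdgeList n} → (∀ {e} → e ∈ S → e ∈ E) → ∀ {a b} → Adj S a b → Adj E a b
  Adj-mono S⊆E (inj₁ ab∈S) = inj₁ (S⊆E ab∈S)
  Adj-mono S⊆E (inj₂ ba∈S) = inj₂ (S⊆E ba∈S)

  Joins : Fin n × Fin n → Fin n → Fin n → Set
  Joins x a b = (a , b) ≡ x ⊎ (b , a) ≡ x

  Joins? : ∀ x a b → Dec (Joins x a b)
  Joins? x a b = ((a , b) ≟ₑ x) ⊎-dec ((b , a) ≟ₑ x)

  Joins-sym : ∀ {x a b} → Joins x b a → Joins x a b
  Joins-sym = [ inj₂ , inj₁ ]

  Adj-∷⁻ : ∀ {x} {E : EdgeList n} {a b} → Adj (x ∷ E) a b → Joins x a b ⊎ Adj E a b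
  Adj-∷⁻ (inj₁ (here ab≡x))  = inj₁ (inj₁ ab≡x)
  Adj-∷⁻ (inj₁ (there ab∈E)) = inj₂ (inj₁ ab∈E)
  Adj-∷⁻ (inj₂ (here ba≡x))  = inj₁ (inj₂ ba≡x)
  Adj-∷⁻ (inj₂ (there ba∈E)) = inj₂ (inj₂ ba∈E)

  Adj-∷⁺ˡ : ∀ {x} {E : EdgeList n} {a b} → Joins x a b → Adj (x ∷ E) a b
  Adj-∷⁺ˡ (inj₁ ab≡x) = inj₁ (here ab≡x)
  Adj-∷⁺ˡ (inj₂ ba≡x) = inj₂ (here ba≡x)

  Adj-∷⁺ʳ : ∀ {x} {E : EdgeList n} {a b} → Adj E a b → Adj (x ∷ E) a b
  Adj-∷⁺ʳ = Adj-mono there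

  Adj-relabel⁺ : ∀ (σ : Permutation′ n) {w : Word n} {a b} → Adj w a b → Adj (relabel σ w) (σ ⟨$⟩ʳ a) (σ ⟨$⟩ʳ b)
  Adj-relabel⁺ σ (inj₁ ab∈w) = inj₁ (∈-map⁺ (relabelLetter σ) ab∈w)
  Adj-relabel⁺ σ (inj₂ ba∈w) = inj₂ (∈-map⁺ (relabelLetter σ) ba∈w)

  Adj-relabel⁻ : ∀ (σ : Permutation′ n) {w : Word n} {a b} → Adj (relabel σ w) (σ ⟨$⟩ʳ a) (σ ⟨$⟩ʳ b) → Adj w a b
  Adj-relabel⁻ σ {w} (inj₁ ab∈σw) = inj₁ (relabel-∈⁻ ab∈σw)
    where
    relabel-∈⁻ : ∀ {a b} → (σ ⟨$⟩ʳ a , σ ⟨$⟩ʳ b) ∈ relabel σ w → (a , b) ∈ w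
    relabel-∈⁻ σab∈σw with ∈-map⁻ (relabelLetter σ) σab∈σw
    ... | (c , d) , cd∈w , σab≡σcd = subst (_∈ w) (sym (cong₂ _,_ (⟨$⟩ʳ-injective σ (proj₁ (,-injective σab≡σcd)))
                                                                 (⟨$⟩ʳ-injective σ (proj₂ (,-injective σab≡σcd))))) cd∈w
  Adj-relabel⁻ σ {w} (inj₂ ba∈σw) = Adj-sym (Adj-relabel⁻ σ (inj₁ ba∈σw))

  simple-head-fresh : ∀ {p q} {E : EdgeList n} → IsSimple ((p , q) ∷ E) → ¬ Adj E p q
  simple-head-fresh (_   ∷ _         , pq∉E ∷ _) (inj₁ pq∈E) = All.lookup pq∉E pq∈E refl
  simple-head-fresh (p<q ∷ E-ordered , _    ∷ _) (inj₂ qp∈E) = FinP.<-asym p<q (All.lookup E-ordered qp∈E)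

  Joins-fresh : ∀ {x} {E : EdgeList n} → IsSimple (x ∷ E) → ∀ {a b} → Joins x a b → ¬ Adj E a b
  Joins-fresh x∷E-simple (inj₁ refl) = simple-head-fresh x∷E-simple
  Joins-fresh x∷E-simple (inj₂ refl) = simple-head-fresh x∷E-simple ∘ Adj-sym

  δ*δ≡𝟙-≟ₑ : ∀ (a b : Fin n) x → δ a (proj₁ x) * δ b (proj₂ x) ≡ 𝟙 ((a , b) ≟ₑ x)
  δ*δ≡𝟙-≟ₑ a b (p , q) = trans (sym (𝟙-× (a ≟ p) (b ≟ q)))
    (𝟙-cong ((a ≟ p) ×-dec (b ≟ q)) ((a , b) ≟ₑ (p , q)) (λ (a≡p , b≡q) → cong₂ _,_ a≡p b≡q) ,-injective)

  adjacencyCount≡𝟙 : ∀ {E : EdgeList n} → IsSimple E → ∀ a b → adjacencyCount E a b ≡ 𝟙 (Adj? E a b)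
  adjacencyCount≡𝟙 {[]}    _ a b = sym (𝟙-no (Adj? [] a b) λ { (inj₁ ()) ; (inj₂ ()) })
  adjacencyCount≡𝟙 {x ∷ E} E-simple@(p<q ∷ E-ordered , _ ∷ E-unique) a b = begin
    basisV (proj₁ x) (proj₂ x) a b + adjacencyCount E a b
      ≡⟨ cong₂ _+_ (cong₂ _+_ (δ*δ≡𝟙-≟ₑ a b x) (trans (*-comm (δ a (proj₂ x)) _) (δ*δ≡𝟙-≟ₑ b a x)))
                   (adjacencyCount≡𝟙 (E-ordered , E-unique) a b) ⟩
    𝟙 ((a , b) ≟ₑ x) + 𝟙 ((b , a) ≟ₑ x) + 𝟙 (Adj? E a b)
      ≡⟨ cong (_+ 𝟙 (Adj? E a b)) (sym (𝟙-⊎ ((a , b) ≟ₑ x) ((b , a) ≟ₑ x) loop-free)) ⟩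
    𝟙 (Joins? x a b) + 𝟙 (Adj? E a b)
      ≡⟨ sym (𝟙-⊎ (Joins? x a b) (Adj? E a b) (Joins-fresh E-simple)) ⟩
    𝟙 (Joins? x a b ⊎-dec Adj? E a b)
      ≡⟨ 𝟙-cong (Joins? x a b ⊎-dec Adj? E a b) (Adj? (x ∷ E) a b) [ Adj-∷⁺ˡ , Adj-∷⁺ʳ ] Adj-∷⁻ ⟩
    𝟙 (Adj? (x ∷ E) a b) ∎
    where
    loop-free : (a , b) ≡ x → (b , a) ≢ x
    loop-free refl ba≡ab = FinP.<⇒≢ p<q (sym (proj₁ (,-injective ba≡ab)))

  LettersIn : EdgeList n → Word n → Set
  LettersIn E w = All.All (λ (a , b) → Adj E a b) w

  lettersIn? : ∀ (E : EdgeList n) w → Dec (LettersIn E w)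
  lettersIn? E = All.all? (λ (a , b) → Adj? E a b)

  wordWeight-simple : ∀ {E : EdgeList n} → IsSimple E → ∀ w → wordWeight E w ≡ ½^ (length w) * 𝟙 (lettersIn? E w)
  wordWeight-simple E-simple []            = sym (*-identityˡ 1ℚ)
  wordWeight-simple {E} E-simple ((a , b) ∷ w) = begin
    ½ * adjacencyCount E a b * wordWeight E w
      ≡⟨ cong₂ (λ x y → ½ * x * y) (adjacencyCount≡𝟙 E-simple a b) (wordWeight-simple E-simple w) ⟩
    ½ * 𝟙 (Adj? E a b) * (½^ (length w) * 𝟙 (lettersIn? E w))
      ≡⟨ regroup ½ (𝟙 (Adj? E a b)) (½^ (length w)) (𝟙 (lettersIn? E w)) ⟩
    ½ * ½^ (length w) * (𝟙 (Adj? E a b) * 𝟙 (lettersIn? E w))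
      ≡⟨ cong (½ * ½^ (length w) *_) (sym (𝟙-× (Adj? E a b) (lettersIn? E w))) ⟩
    ½ * ½^ (length w) * 𝟙 (Adj? E a b ×-dec lettersIn? E w)
      ≡⟨ cong (½ * ½^ (length w) *_) (𝟙-cong (Adj? E a b ×-dec lettersIn? E w) (lettersIn? E ((a , b) ∷ w))
                                              (λ (ab∈E , w⊆E) → ab∈E ∷ w⊆E) (λ { (ab∈E ∷ w⊆E) → ab∈E , w⊆E })) ⟩
    ½ * ½^ (length w) * 𝟙 (lettersIn? E ((a , b) ∷ w)) ∎
    where
    regroup : ∀ h x y z → h * x * (y * z) ≡ h * y * (x * z)
    regroup = solve-∀ ℚ-ring

module _ {n : ℕ} where

  HasAdjacency : EdgeList n → (Fin n → Fin n → Set) → Set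
  HasAdjacency S Q = ∀ a b → (Adj S a b → Q a b) × (Q a b → Adj S a b)

  hasAdjacency? : ∀ S {Q : Fin n → Fin n → Set} → (∀ a b → Dec (Q a b)) → Dec (HasAdjacency S Q)
  hasAdjacency? S Q? = FinP.all? λ a → FinP.all? λ b → (Adj? S a b →-dec Q? a b) ×-dec (Q? a b →-dec Adj? S a b)

  _∖_ : (Fin n → Fin n → Set) → Fin n × Fin n → Fin n → Fin n → Set
  (Q ∖ x) a b = Q a b × ¬ Joins x a b

  _∖?_ : ∀ {Q : Fin n → Fin n → Set} → (∀ a b → Dec (Q a b)) → ∀ x a b → Dec ((Q ∖ x) a b)
  (Q? ∖? x) a b = Q? a b ×-dec ¬? (Joins? x a b)

  HasAdjacency-∷⁻ : ∀ {x S Q} → (∀ {a b} → Joins x a b → ¬ Adj S a b) →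
    HasAdjacency (x ∷ S) Q → HasAdjacency S (Q ∖ x)
  HasAdjacency-∷⁻ S-fresh x∷S≐Q a b =
    (λ ab∈S → proj₁ (x∷S≐Q a b) (Adj-∷⁺ʳ ab∈S) , λ joins → S-fresh joins ab∈S) ,
    (λ (Qab , ¬joins) → [ ⊥-elim ∘ ¬joins , id ] (Adj-∷⁻ (proj₂ (x∷S≐Q a b) Qab)))

  HasAdjacency-∷⁺ : ∀ {x S Q} → (∀ {a b} → Joins x a b → Q a b) →
    HasAdjacency S (Q ∖ x) → HasAdjacency (x ∷ S) Q
  HasAdjacency-∷⁺ {x} Joins⇒Q S≐Q∖x a b =
    [ Joins⇒Q , (λ ab∈S → proj₁ (proj₁ (S≐Q∖x a b) ab∈S)) ] ∘ Adj-∷⁻ ,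
    λ Qab → case Joins? x a b of λ where
      (yes joins) → Adj-∷⁺ˡ joins
      (no ¬joins) → Adj-∷⁺ʳ (proj₂ (S≐Q∖x a b) (Qab , ¬joins))

  countWithAdjacency : ∀ {Q : Fin n → Fin n → Set} → (∀ a b → Dec (Q a b)) → EdgeList n → ℚ
  countWithAdjacency Q? T = sumList (λ S → 𝟙 (hasAdjacency? S Q?)) (subsets T)

  module _ {x : Fin n × Fin n} {T : EdgeList n} (x∷T-simple : IsSimple (x ∷ T))
           {Q : Fin n → Fin n → Set} (Q? : ∀ a b → Dec (Q a b)) (Q-sym : ∀ {a b} → Q a b → Q b a) where

    private
      fresh : ∀ {S} → S ∈ subsets T → ∀ {a b} → Joins x a b → ¬ Adj S a b
      fresh S∈ joins = Joins-fresh x∷T-simple joins ∘ Adj-mono (subsets-⊆ T S∈)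

      sumList-zero-on : (f : EdgeList n → ℚ) → (∀ {S} → S ∈ subsets T → f S ≡ 0ℚ) → sumList f (subsets T) ≡ 0ℚ
      sumList-zero-on f f≡0 = trans (sumList-cong (subsets T) (λ _ S∈ → f≡0 S∈)) (sumList-zero (subsets T))

    count-avoiding-x≡0 : Q (proj₁ x) (proj₂ x) → countWithAdjacency Q? T ≡ 0ℚ
    count-avoiding-x≡0 Qx = sumList-zero-on _ λ {S} S∈ →
      𝟙-no (hasAdjacency? S Q?) λ S≐Q → fresh S∈ (inj₁ refl) (proj₂ (S≐Q _ _) Qx)

    count-containing-x≡0 : ¬ Q (proj₁ x) (proj₂ x) → sumList (λ S → 𝟙 (hasAdjacency? (x ∷ S) Q?)) (subsets T) ≡ 0ℚ
    count-containing-x≡0 ¬Qx = sumList-zero-on _ λ {S} _ →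
      𝟙-no (hasAdjacency? (x ∷ S) Q?) λ x∷S≐Q → ¬Qx (proj₁ (x∷S≐Q _ _) (Adj-∷⁺ˡ (inj₁ refl)))

    count-containing-x : Q (proj₁ x) (proj₂ x) →
      sumList (λ S → 𝟙 (hasAdjacency? (x ∷ S) Q?)) (subsets T) ≡ countWithAdjacency (Q? ∖? x) T
    count-containing-x Qx = sumList-cong (subsets T) λ S S∈ →
      𝟙-cong (hasAdjacency? (x ∷ S) Q?) (hasAdjacency? S (Q? ∖? x))
             (HasAdjacency-∷⁻ (fresh S∈)) (HasAdjacency-∷⁺ Joins⇒Q)
      where
      Joins⇒Q : ∀ {a b} → Joins x a b → Q a b
      Joins⇒Q (inj₁ refl) = Qx
      Joins⇒Q (inj₂ refl) = Q-sym Qx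

  countWithAdjacency≡1 : ∀ (T : EdgeList n) → IsSimple T →
    ∀ {Q : Fin n → Fin n → Set} (Q? : ∀ a b → Dec (Q a b)) →
    (∀ {a b} → Q a b → Q b a) → (∀ {a b} → Q a b → Adj T a b) → countWithAdjacency Q? T ≡ 1ℚ
  countWithAdjacency≡1 [] _ Q? _ Q⊆T =
    trans (+-identityʳ _) (𝟙-yes (hasAdjacency? [] Q?) (λ a b → (λ { (inj₁ ()) ; (inj₂ ()) }) , Q⊆T))
  countWithAdjacency≡1 (x ∷ T) x∷T-simple@(_ ∷ T-ordered , _ ∷ T-unique) {Q} Q? Q-sym Q⊆x∷T =
    trans (sumList-subsets-∷ (λ S → 𝟙 (hasAdjacency? S Q?)) x T) (by-cases (Q? (proj₁ x) (proj₂ x)))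
    where
    T-simple : IsSimple T
    T-simple = T-ordered , T-unique
    containing-x = sumList (λ S → 𝟙 (hasAdjacency? (x ∷ S) Q?)) (subsets T)
    by-cases : Dec (Q (proj₁ x) (proj₂ x)) → countWithAdjacency Q? T + containing-x ≡ 1ℚ
    by-cases (yes Qx) = begin
      countWithAdjacency Q? T + containing-x  ≡⟨ cong (_+ containing-x) (count-avoiding-x≡0 x∷T-simple Q? Q-sym Qx) ⟩
      0ℚ + containing-x                       ≡⟨ +-identityˡ containing-x ⟩
      containing-x                            ≡⟨ count-containing-x x∷T-simple Q? Q-sym Qx ⟩
      countWithAdjacency (Q? ∖? x) T          ≡⟨ countWithAdjacency≡1 T T-simple (Q? ∖? x) Q∖x-sym Q∖x⊆T ⟩
      1ℚ                                      ∎
      where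
      Q∖x-sym : ∀ {a b} → (Q ∖ x) a b → (Q ∖ x) b a
      Q∖x-sym (Qab , ¬joins) = Q-sym Qab , ¬joins ∘ Joins-sym
      Q∖x⊆T : ∀ {a b} → (Q ∖ x) a b → Adj T a b
      Q∖x⊆T (Qab , ¬joins) = [ ⊥-elim ∘ ¬joins , id ] (Adj-∷⁻ (Q⊆x∷T Qab))
    by-cases (no ¬Qx) = begin
      countWithAdjacency Q? T + containing-x
        ≡⟨ cong (countWithAdjacency Q? T +_) (count-containing-x≡0 x∷T-simple Q? Q-sym ¬Qx) ⟩
      countWithAdjacency Q? T + 0ℚ
        ≡⟨ +-identityʳ _ ⟩
      countWithAdjacency Q? T
        ≡⟨ countWithAdjacency≡1 T T-simple Q? Q-sym Q⊆T ⟩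
      1ℚ ∎
      where
      Q⊆T : ∀ {a b} → Q a b → Adj T a b
      Q⊆T {a} {b} Qab = [ ⊥-elim ∘ ¬Qx ∘ Joins⇒Qx , id ] (Adj-∷⁻ (Q⊆x∷T Qab))
        where
        Joins⇒Qx : Joins x a b → Q (proj₁ x) (proj₂ x)
        Joins⇒Qx (inj₁ refl) = Qab
        Joins⇒Qx (inj₂ refl) = Q-sym Qab

  countWithAdjacency-word : ∀ (T : EdgeList n) → IsSimple T → (w : Word n) →
    countWithAdjacency (Adj? w) T ≡ 𝟙 (lettersIn? T w)
  countWithAdjacency-word T T-simple w with lettersIn? T w
  ... | yes w⊆T = countWithAdjacency≡1 T T-simple (Adj? w) Adj-sym [ All.lookup w⊆T , Adj-sym ∘ All.lookup w⊆T ]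
  ... | no w⊈T  = trans (sumList-cong (subsets T) λ S S∈ → 𝟙-no (hasAdjacency? S (Adj? w)) λ S≐w →
                           w⊈T (All.tabulate λ ab∈w → Adj-mono (subsets-⊆ T S∈) (proj₂ (S≐w _ _) (inj₁ ab∈w))))
                        (sumList-zero (subsets T))

  HasAdjacency-nonempty : ∀ {S : EdgeList n} {a b w} → HasAdjacency S (Adj ((a , b) ∷ w)) → 1 ≤ length S
  HasAdjacency-nonempty {[]}    {a} {b} S≐w with proj₂ (S≐w a b) (inj₁ (here refl))
  ... | inj₁ ()
  ... | inj₂ ()
  HasAdjacency-nonempty {_ ∷ _} _ = s≤s z≤n

  HasAdjacency⇒length-≤ : ∀ {T : EdgeList n} → IsSimple T → ∀ {S} → S ∈ subsets T →
    ∀ {w : Word n} → HasAdjacency S (Adj w) → length S ≤ length w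
  HasAdjacency⇒length-≤ {T} (T-ordered , T-unique) {S} S∈ {w} S≐w =
    ℕP.≤-trans (Unique-⊆⇒length-≤ (subsets-Unique T-unique S∈) S⊆) (ℕP.≤-reflexive (length-map sorted w))
    where
    sorted : Fin n × Fin n → Fin n × Fin n
    sorted (a , b) with b Fin.<? a
    ... | yes _ = b , a
    ... | no _  = a , b
    sorted-< : ∀ {a b} → a Fin.< b → sorted (a , b) ≡ (a , b)
    sorted-< {a} {b} a<b with b Fin.<? a
    ... | yes b<a = ⊥-elim (FinP.<-asym a<b b<a)
    ... | no _    = refl
    sorted-> : ∀ {a b} → a Fin.< b → sorted (b , a) ≡ (a , b)
    sorted-> {a} {b} a<b with a Fin.<? b
    ... | yes _   = refl
    ... | no a≮b  = ⊥-elim (a≮b a<b)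
    S⊆ : ∀ {e} → e ∈ S → e ∈ map sorted w
    S⊆ {a , b} ab∈S with proj₁ (S≐w a b) (inj₁ ab∈S)
    ... | inj₁ ab∈w = subst (_∈ map sorted w) (sorted-< a<b) (∈-map⁺ sorted ab∈w)
      where a<b = All.lookup T-ordered (subsets-⊆ T S∈ ab∈S)
    ... | inj₂ ba∈w = subst (_∈ map sorted w) (sorted-> a<b) (∈-map⁺ sorted ba∈w)
      where a<b = All.lookup T-ordered (subsets-⊆ T S∈ ab∈S)

  module _ (σ : Permutation′ n) {S S′ : EdgeList n} {Q Q′ : Fin n → Fin n → Set}
           (S⇒S′ : ∀ {a b} → Adj S a b → Adj S′ (σ ⟨$⟩ʳ a) (σ ⟨$⟩ʳ b))
           (S′⇒S : ∀ {a b} → Adj S′ (σ ⟨$⟩ʳ a) (σ ⟨$⟩ʳ b) → Adj S a b)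
           (Q⇒Q′ : ∀ {a b} → Q a b → Q′ (σ ⟨$⟩ʳ a) (σ ⟨$⟩ʳ b))
           (Q′⇒Q : ∀ {a b} → Q′ (σ ⟨$⟩ʳ a) (σ ⟨$⟩ʳ b) → Q a b) where

    HasAdjacency-relabel⁺ : HasAdjacency S Q → HasAdjacency S′ Q′
    HasAdjacency-relabel⁺ S≐Q a′ b′ =
      (λ adj → back Q′ (Q⇒Q′ (proj₁ (S≐Q a b) (S′⇒S (forth (Adj S′) adj))))) ,
      (λ q′  → back (Adj S′) (S⇒S′ (proj₂ (S≐Q a b) (Q′⇒Q (forth Q′ q′)))))
      where
      a = σ ⟨$⟩ˡ a′
      b = σ ⟨$⟩ˡ b′
      forth : ∀ (P : Fin n → Fin n → Set) → P a′ b′ → P (σ ⟨$⟩ʳ a) (σ ⟨$⟩ʳ b)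
      forth P = subst₂ P (sym (Permutation.inverseʳ σ)) (sym (Permutation.inverseʳ σ))
      back : ∀ (P : Fin n → Fin n → Set) → P (σ ⟨$⟩ʳ a) (σ ⟨$⟩ʳ b) → P a′ b′
      back P = subst₂ P (Permutation.inverseʳ σ) (Permutation.inverseʳ σ)

    HasAdjacency-relabel⁻ : HasAdjacency S′ Q′ → HasAdjacency S Q
    HasAdjacency-relabel⁻ S′≐Q′ a b =
      (λ adj → Q′⇒Q (proj₁ (S′≐Q′ _ _) (S⇒S′ adj))) , (λ q → S′⇒S (proj₂ (S′≐Q′ _ _) (Q⇒Q′ q)))

  hasAdjacency-Isomorphic : ∀ {S S′ : EdgeList n} ((σ , S≅S′) : Isomorphic S S′) (w : Word n) →
    𝟙 (hasAdjacency? S (Adj? w)) ≡ 𝟙 (hasAdjacency? S′ (Adj? (relabel σ w)))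
  hasAdjacency-Isomorphic (σ , S≅S′) w = 𝟙-cong (hasAdjacency? _ (Adj? w)) (hasAdjacency? _ (Adj? (relabel σ w)))
    (HasAdjacency-relabel⁺ σ S⇒S′ S′⇒S (Adj-relabel⁺ σ) (Adj-relabel⁻ σ))
    (HasAdjacency-relabel⁻ σ S⇒S′ S′⇒S (Adj-relabel⁺ σ) (Adj-relabel⁻ σ))
    where
    S⇒S′ = λ {a} {b} → Equivalence.to (S≅S′ a b)
    S′⇒S = λ {a} {b} → Equivalence.from (S≅S′ a b)

-- As for InW, the summand of forestSum cannot be named.
mutual
  private
    forestSum-summand : ∀ {n} r (C : EdgeList n → ℚ) (T S : EdgeList n) →
      (¬ (1 ≤ length S × length S ≤ r) → C S ≡ 0ℚ) → _ ≡ C S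

  forestSum≡sumList : ∀ {n} r (C : EdgeList n → ℚ) (T : EdgeList n) →
    (∀ {S} → S ∈ subsets T → ¬ (1 ≤ length S × length S ≤ r) → C S ≡ 0ℚ) →
    forestSum r C T ≡ sumList C (subsets T)
  forestSum≡sumList r C T C-vanishes =
    sumList-cong (subsets T) (λ S S∈ → forestSum-summand r C T S (C-vanishes S∈))

  forestSum-summand r C T S C≡0 with 1 ≤? length S | length S ≤? r
  ... | yes _   | yes _   = refl
  ... | yes _   | no |S|≰r = sym (C≡0 (λ (_ , |S|≤r) → |S|≰r |S|≤r))
  ... | no 1≰|S| | _      = sym (C≡0 (λ (1≤|S| , _) → 1≰|S| 1≤|S|))

module ForestExpansion {n : ℕ} (α β : ℚ) (α-eq : α * (cardℚ n - 1ℚ - 1ℚ) ≡ 1ℚ) (β-eq : β * (cardℚ n - 1ℚ) ≡ α)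
                       (r : ℕ) (1≤r : 1 ≤ r) where

  open Projection {n} α β public
  open OntoW α-eq β-eq public

  traceW : Operator n → ℚ
  traceW = frameTrace weight frame

  traceW-relabel : ∀ (σ : Permutation′ n) w → traceW (actWord (relabel σ w)) ≡ traceW (actWord w)
  traceW-relabel σ w = frameTrace-conjugate weight frame σ (weight-act σ) (frame-act σ) {actWord w}
                                            (actWord-congruent (relabel σ w)) (actWord-relabel σ w)

  coefficient : EdgeList n → ℚ
  coefficient S = sumWords r (λ w → ½^ r * 𝟙 (hasAdjacency? S (Adj? w)) * traceW (actWord w))

  coefficient-Isomorphic : ∀ {S S′} → Isomorphic S S′ → coefficient S ≡ coefficient S′
  coefficient-Isomorphic {S} {S′} S≅S′@(σ , _) = begin
    coefficient S
      ≡⟨ sumWords-cong r (λ w _ → cong₂ (λ h t → ½^ r * h * t)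
                                         (hasAdjacency-Isomorphic S≅S′ w) (sym (traceW-relabel σ w))) ⟩
    sumWords r (λ w → ½^ r * 𝟙 (hasAdjacency? S′ (Adj? (relabel σ w))) * traceW (actWord (relabel σ w)))
      ≡⟨ sym (sumWords-relabel r σ (λ w → ½^ r * 𝟙 (hasAdjacency? S′ (Adj? w)) * traceW (actWord w))) ⟩
    coefficient S′ ∎

  coefficient-vanishes : ∀ {T} → IsSimple T → ∀ {S} → S ∈ subsets T →
    ¬ (1 ≤ length S × length S ≤ r) → coefficient S ≡ 0ℚ
  coefficient-vanishes T-simple {S} S∈ out-of-range = trans (sumWords-cong r term≡0) (sumWords-zero r)
    where
    in-range : ∀ w → length w ≡ r → HasAdjacency S (Adj w) → 1 ≤ length S × length S ≤ r
    in-range []      |w|≡r _   = case subst (1 ≤_) (sym |w|≡r) 1≤r of λ ()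
    in-range (_ ∷ _) |w|≡r S≐w =
      HasAdjacency-nonempty S≐w , subst (length S ≤_) |w|≡r (HasAdjacency⇒length-≤ T-simple S∈ S≐w)
    term≡0 : ∀ w → length w ≡ r → ½^ r * 𝟙 (hasAdjacency? S (Adj? w)) * traceW (actWord w) ≡ 0ℚ
    term≡0 w |w|≡r = begin
      ½^ r * 𝟙 (hasAdjacency? S (Adj? w)) * traceW (actWord w)
        ≡⟨ cong (λ h → ½^ r * h * traceW (actWord w))
                (𝟙-no (hasAdjacency? S (Adj? w)) (out-of-range ∘ in-range w |w|≡r)) ⟩
      ½^ r * 0ℚ * traceW (actWord w)
        ≡⟨ trans (cong (_* traceW (actWord w)) (*-zeroʳ (½^ r))) (*-zeroˡ (traceW (actWord w))) ⟩
      0ℚ ∎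

  forestSum-coefficient : ∀ {T} → IsSimple T →
    forestSum r coefficient T ≡ sumWords r (λ w → wordWeight T w * traceW (actWord w))
  forestSum-coefficient {T} T-simple = begin
    forestSum r coefficient T
      ≡⟨ forestSum≡sumList r coefficient T (coefficient-vanishes T-simple) ⟩
    sumList coefficient (subsets T)
      ≡⟨ sumList-sumWords r (λ S w → ½^ r * 𝟙 (hasAdjacency? S (Adj? w)) * traceW (actWord w)) (subsets T) ⟩
    sumWords r (λ w → sumList (λ S → ½^ r * 𝟙 (hasAdjacency? S (Adj? w)) * traceW (actWord w)) (subsets T))
      ≡⟨ sumWords-cong r per-word ⟩
    sumWords r (λ w → wordWeight T w * traceW (actWord w)) ∎
    where
    per-word : ∀ w → length w ≡ r →
      sumList (λ S → ½^ r * 𝟙 (hasAdjacency? S (Adj? w)) * traceW (actWord w)) (subsets T) ≡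
      wordWeight T w * traceW (actWord w)
    per-word w |w|≡r = begin
      sumList (λ S → ½^ r * 𝟙 (hasAdjacency? S (Adj? w)) * t) (subsets T)
        ≡⟨ sumList-cong (subsets T) (λ S _ → xy∙z≈y∙xz (½^ r) (𝟙 (hasAdjacency? S (Adj? w))) t) ⟩
      sumList (λ S → 𝟙 (hasAdjacency? S (Adj? w)) * (½^ r * t)) (subsets T)
        ≡⟨ sumList-*ʳ (½^ r * t) (λ S → 𝟙 (hasAdjacency? S (Adj? w))) (subsets T) ⟩
      sumList (λ S → 𝟙 (hasAdjacency? S (Adj? w))) (subsets T) * (½^ r * t)
        ≡⟨ cong (_* (½^ r * t)) (countWithAdjacency-word T T-simple w) ⟩
      𝟙 (lettersIn? T w) * (½^ r * t)
        ≡⟨ sym (xy∙z≈y∙xz (½^ r) (𝟙 (lettersIn? T w)) t) ⟩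
      ½^ r * 𝟙 (lettersIn? T w) * t
        ≡⟨ cong (λ k → ½^ k * 𝟙 (lettersIn? T w) * t) (sym |w|≡r) ⟩
      ½^ (length w) * 𝟙 (lettersIn? T w) * t
        ≡⟨ cong (_* t) (sym (wordWeight-simple T-simple w)) ⟩
      wordWeight T w * t ∎
      where
      t = traceW (actWord w)

cardℚ-nonNegative : ∀ m → NonNegative (cardℚ m)
cardℚ-nonNegative zero    = _
cardℚ-nonNegative (suc m) = nonNeg+nonNeg⇒nonNeg 1ℚ (cardℚ m) {{cardℚ-nonNegative m}}

projection-constants : ∀ n → 3 ≤ n →
  Σ ℚ λ α → Σ ℚ λ β → α * (cardℚ n - 1ℚ - 1ℚ) ≡ 1ℚ × β * (cardℚ n - 1ℚ) ≡ α
projection-constants (suc (suc (suc m))) (s≤s (s≤s (s≤s z≤n))) = 1/ n-2 , 1/ n-2 * 1/ n-1 , α-eq , β-eq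
  where
  n-2 = 1ℚ + cardℚ m
  n-1 = 1ℚ + n-2
  instance
    cardℚ-m-nonNegative : NonNegative (cardℚ m)
    cardℚ-m-nonNegative = cardℚ-nonNegative m
    n-2-positive : Positive n-2
    n-2-positive = pos+nonNeg⇒pos 1ℚ (cardℚ m)
    n-1-positive : Positive n-1
    n-1-positive = pos+pos⇒pos 1ℚ n-2
    n-2-nonZero : NonZero n-2
    n-2-nonZero = pos⇒nonZero n-2
    n-1-nonZero : NonZero n-1
    n-1-nonZero = pos⇒nonZero n-1
  minus-2 : ∀ x → 1ℚ + (1ℚ + (1ℚ + x)) - 1ℚ - 1ℚ ≡ 1ℚ + x
  minus-2 = solve-∀ ℚ-ring
  minus-1 : ∀ x → 1ℚ + (1ℚ + (1ℚ + x)) - 1ℚ ≡ 1ℚ + (1ℚ + x)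
  minus-1 = solve-∀ ℚ-ring
  α-eq : 1/ n-2 * (cardℚ (suc (suc (suc m))) - 1ℚ - 1ℚ) ≡ 1ℚ
  α-eq = trans (cong (1/ n-2 *_) (minus-2 (cardℚ m))) (*-inverseˡ n-2)
  β-eq : 1/ n-2 * 1/ n-1 * (cardℚ (suc (suc (suc m))) - 1ℚ) ≡ 1/ n-2
  β-eq = begin
    1/ n-2 * 1/ n-1 * (cardℚ (suc (suc (suc m))) - 1ℚ)  ≡⟨ cong (1/ n-2 * 1/ n-1 *_) (minus-1 (cardℚ m)) ⟩
    1/ n-2 * 1/ n-1 * n-1                               ≡⟨ *-assoc (1/ n-2) (1/ n-1) n-1 ⟩
    1/ n-2 * (1/ n-1 * n-1)                             ≡⟨ cong (1/ n-2 *_) (*-inverseˡ n-1) ⟩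
    1/ n-2 * 1ℚ                                         ≡⟨ *-identityʳ (1/ n-2) ⟩
    1/ n-2                                              ∎

mainTheorem6 : (n r : ℕ) → 4 ≤ n → 1 ≤ r →
    Σ (EdgeList n → ℚ) λ C →
      (∀ S S' → 1 ≤ length S → length S ≤ r → Isomorphic S S' → C S ≡ C S') ×
      (∀ (T : EdgeList n) → IsTree T →
        ∀ (d : ℕ) (b : Fin d → Vec' n) (A : Fin d → Fin d → ℚ) →
          IsBasisW b → IsMatrixOf T b A →
          trace (matPow A r) ≡ forestSum r C T)
mainTheorem6 n r 4≤n 1≤r with projection-constants n (ℕP.≤-trans (ℕP.n≤1+n 3) 4≤n)
... | α , β , α-eq , β-eq =
  coefficient , (λ _ _ _ _ → coefficient-Isomorphic) , λ T T-tree d b A basis A-represents-X → begin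
    trace (matPow A r)
      ≡⟨ trace≡frameTrace basis weight frame frame∈W resolution {A = matPow A r}
           (^-congruent r (X-congruent T)) (^-linear r (X-congruent T) (X-linear T))
           (HasMatrix-^ b {A = A} (X-congruent T) (X-linear T) A-represents-X r) ⟩
    frameTrace weight frame (X T ^ r)
      ≡⟨ frameTrace-X^ T r weight frame ⟩
    sumWords r (λ w → wordWeight T w * traceW (actWord w))
      ≡⟨ sym (forestSum-coefficient (proj₁ T-tree)) ⟩
    forestSum r coefficient T ∎
  where open ForestExpansion {n} α β α-eq β-eq r 1≤r
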